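{- Let $K$ be a finite field of characteristic $p$ and order $q$, and let $s$ be a positive integer with $\gcd(s,q-1)=1$. If $|\mathcal{W}_{K,s}|=4$, then $\tau$ does not permute $\mathcal{W}_{K,s}$ as a $4$-cycle.
   Context: $\zeta=\exp(2\pi i/p)$, $\psi(x)=\zeta^{\mathrm{Tr}(x)}$ with $\mathrm{Tr}\colon K\to\mathbb{F}_p$ the absolute trace, $W_u=\sum_{x\in K}\psi(x^s-ux)$, and $\mathcal{W}_{K,s}=\{W_u:u\in K^\times\}$. Let $\gamma$ be a generator of $\mathbb{F}_p^\times$ and $\sigma\in\mathrm{Gal}(\mathbb{Q}(\zeta)/\mathbb{Q})$ with $\sigma(\zeta)=\zeta^\gamma$; it is known that $\sigma(W_u)=W_{\gamma^{1-1/s}u}$ (with $1/s$ the inverse of $s$ mod $p-1$), so $\sigma$ maps $\mathcal{W}_{K,s}$ to itself, and $\tau$ denotes the resulting permutation of $\mathcal{W}_{K,s}$. -}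

module Defs where

open import Level using (Level; suc; _⊔_)
open import Algebra.Bundles using (CommutativeRing)
open import Data.Nat as ℕ using (ℕ; zero; NonZero)
open import Data.Nat.DivMod using (_%_)
open import Data.Fin using (Fin; toℕ)
open import Data.List using (List; length; filter; foldr; map)
open import Data.List.Base using () renaming (allFin to allFinL)
open import Data.Integer as ℤ using (ℤ; +_)
open import Data.Product using (∃; Σ; _×_)
open import Relation.Nullary using (¬_; yes; no)
open import Relation.Binary using (Decidable)
open import Relation.Binary.PropositionalEquality using (_≡_)

record FiniteField (c ℓ : Level) : Set (suc (c ⊔ ℓ)) where
  field
    cring : CommutativeRing c ℓ
  open CommutativeRing cring public
  field
    1≉0       : ¬ (1# ≈ 0#)
    inverse   : ∀ x → ¬ (x ≈ 0#) → ∃ λ y → (x * y) ≈ 1#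
    _≟_       : Decidable _≈_
    order     : ℕ
    enum      : Fin order → Carrier
    enum-surj : ∀ x → ∃ λ i → enum i ≈ x
    enum-inj  : ∀ i j → enum i ≈ enum j → i ≡ j

module _ {c ℓ : Level} (K : FiniteField c ℓ) where
  open FiniteField K

  pow : Carrier → ℕ → Carrier
  pow x zero = 1#
  pow x (ℕ.suc n) = x * pow x n

  ι : ℕ → Carrier
  ι zero = 0#
  ι (ℕ.suc n) = 1# + ι n

  -- absolute trace K → F_p, where q = p^n:  Tr(x) = Σ_{i<n} x^(p^i)
  -- (its value lies in the prime field {ι j : j < p}).
  Tr : (p n : ℕ) → Carrier → Carrier
  Tr p zero x = 0#
  Tr p (ℕ.suc n) x = pow x (p ℕ.^ n) + Tr p n x

  count : (p n s : ℕ) → Carrier → Fin p → ℕ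
  count p n s u j =
    length (filter (λ i → Tr p n (pow (enum i) s - (u * enum i)) ≟ ι (toℕ j))
                   (allFinL order))

  -- The Weil sum W_u = Σ_{x∈K} ζ^{Tr(x^s - u x)} = Σ_{j ∈ F_p} N_j(u) ζ^j,
  -- represented by its coefficient vector in ℤ^p (see ZζEq below).
  W : (p n s : ℕ) → Carrier → Fin p → ℤ
  W p n s u j = + count p n s u j

-- Model of ℤ[ζ], ζ = exp(2πi/p), p prime: an element Σ_j a_j ζ^j is given by
-- a coefficient vector a : Fin p → ℤ; since the minimal polynomial of ζ is
-- 1 + X + ... + X^(p-1), two vectors give the same element of ℤ[ζ] ⊂ ℂ
-- iff their difference is a constant vector.
ZζEq : {p : ℕ} → (Fin p → ℤ) → (Fin p → ℤ) → Set
ZζEq {p} a b = ∃ λ (c : ℤ) → ∀ j → a j ≡ b j ℤ.+ c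

-- The Galois automorphism σ with σ(ζ) = ζ^γ, acting on coefficient vectors:
-- σ(Σ_j a_j ζ^j) = Σ_j a_j ζ^(γ j mod p), so the coefficient of ζ^k is
-- Σ_{j : γ j ≡ k mod p} a_j.
σ : (p γ : ℕ) .{{_ : NonZero p}} → (Fin p → ℤ) → (Fin p → ℤ)
σ p γ a k = foldr ℤ._+_ (+ 0)
  (map (λ j → sel ((γ ℕ.* toℕ j) % p ℕ.≟ toℕ k) (a j)) (allFinL p))
  where
  sel : ∀ {P : Set} → Relation.Nullary.Dec P → ℤ → ℤ
  sel (yes _) z = z
  sel (no _)  _ = + 0

σ^ : (p γ : ℕ) .{{_ : NonZero p}} → ℕ → (Fin p → ℤ) → (Fin p → ℤ)
σ^ p γ zero a = a
σ^ p γ (ℕ.suc k) a = σ p γ (σ^ p γ k a)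

IsGenerator : (p γ : ℕ) .{{_ : NonZero p}} → Set
IsGenerator p γ = (1 ℕ.≤ γ) × (γ ℕ.< p)
  × (∀ k → 1 ℕ.≤ k → k ℕ.< p ℕ.∸ 1 → ¬ ((γ ℕ.^ k) % p ≡ 1))

{-# OPTIONS --safe #-}
-- Let c = γ^(1-1/s). Substituting x ↦ γ^(1/s) x in the Weil sum shows σ(W_u) = W_{cu}.  If σ permuted
-- the four values of W as a 4-cycle, they would be the classes of W_{u₀}, W_{cu₀}, W_{c²u₀}, W_{c³u₀};
-- multiplication by c permutes K^× and shifts these classes cyclically, so they all have the same size m
-- and q = 1 + 4m.  On the other hand ∑_{u ∈ K} W_u = q (only x = 0 contributes) and W_0 = ∑_x ψ(x) = 0,
-- so comparing the coefficients of ζ⁰ and of ζ^j for a nonzero trace value j gives q = m·B with B ∈ ℤ.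
-- Hence m divides 1 + 4m, so m = 1 and q = 5.  But then p = 5 and s is odd, so x ↦ -x shows that every
-- W_u is fixed by ζ ↦ ζ⁻¹ = σ², and τ has no 4-cycle after all.
module Submission where

open import Defs
open import Level using (Level)
open import Data.Nat using (ℕ; _^_; _∸_; _≤_; NonZero)
open import Data.Nat.GCD using (gcd)
open import Data.Nat.Primality using (Prime)
open import Data.Fin using (Fin; toℕ)
open import Data.Product using (∃; _×_)
open import Relation.Nullary using (¬_)
open import Relation.Binary.PropositionalEquality using (_≡_)

open import Level using (0ℓ)
open import Data.Nat as ℕ using (zero; suc; z≤n; s≤s; _<_; _!)
import Data.Nat.Properties as ℕ
open import Data.Nat.Divisibility
  using (_∣_; divides; ∣⇒≤; m∣m*n; n∣m*n; ∣m+n∣m⇒∣n; ∣m∣n⇒∣m+n; ∣-refl; ∣1⇒≡1; >⇒∤; n∣m⇒m%n≡0)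
open import Data.Nat.DivMod using (_%_; _/_; m/n*n≡m; m%n<n; m≡m%n+[m/n]*n; m<n⇒m%n≡m)
open import Data.Nat.GCD using (gcd-greatest; module Bézout)
open import Data.Nat.Coprimality using (coprime-Bézout; gcd≡1⇒coprime)
open import Data.Nat.Primality using (euclidsLemma; prime⇒nonTrivial; prime?; prime⇒irreducible)
open import Data.Nat.Combinatorics using (_C_; nCk≡n!/k![n-k]!; k![n∸k]!∣n!; nCn≡1)
open import Data.Fin using (fromℕ; fromℕ<; inject₁; punchOut) renaming (zero to fzero; suc to fsuc)
open import Data.Fin.Properties
  using (toℕ-inject₁; toℕ-fromℕ; toℕ-fromℕ<; toℕ<n; toℕ-injective; suc-injective; nonZeroIndex;
         punchOut-injective; any?; all?; injective⇒≤; ¬∀⟶∃¬)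
  renaming (_≟_ to _≟ᶠ_)
open import Data.Fin.Patterns using (0F; 1F; 2F; 3F; 4F)
open import Data.Fin.Permutation using (permutation)
open import Data.Integer as ℤ using (ℤ; +_)
import Data.Integer.Properties as ℤ
open import Data.List using (length; filter; tabulate; foldr; map)
open import Data.List.Base using () renaming (allFin to allFinL)
open import Data.List.Properties using (map-tabulate)
open import Data.Product using (∃₂; _,_; proj₁; proj₂)
open import Data.Sum using (inj₁; inj₂)
open import Data.Empty using (⊥-elim)
open import Algebra.Bundles using (CommutativeMonoid)
open import Function using (_∘_)
open import Function.Bundles using (Inverse)
open import Function.Construct.Composition using () renaming (inverse to _↔∘↔_)
open import Relation.Nullary using (Dec; yes; no; ¬?; _×-dec_; _→-dec_)
open import Relation.Nullary.Decidable using (from-yes)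
open import Relation.Unary using (Decidable)
open import Relation.Binary using (Setoid; IsEquivalence)
open import Relation.Binary.PropositionalEquality as ≡ using (_≗_)


-- Arithmetic

prime⇒2≤ : ∀ {p} → Prime p → 2 ≤ p
prime⇒2≤ {p} pr = ℕ.nonTrivial⇒n>1 p {{prime⇒nonTrivial pr}}

prime∤m! : ∀ {p} → Prime p → ∀ m → m < p → ¬ p ∣ m !
prime∤m! pr zero    m<p p∣1 = ℕ.≤⇒≯ (∣⇒≤ p∣1) (prime⇒2≤ pr)
prime∤m! pr (suc m) m<p p∣m! with euclidsLemma (suc m) (m !) pr p∣m!
... | inj₁ p∣1+m = ℕ.<⇒≱ m<p (∣⇒≤ p∣1+m)
... | inj₂ p∣m!  = prime∤m! pr m (ℕ.<-trans (ℕ.n<1+n m) m<p) p∣m!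

n∣n! : ∀ n → 0 < n → n ∣ n !
n∣n! (suc n) _ = m∣m*n (n !)

prime∣pCk : ∀ {p} → Prime p → ∀ k → 1 ≤ k → k < p → p ∣ p C k
prime∣pCk {p} pr k 1≤k k<p
  with euclidsLemma (p C k) (k ! ℕ.* (p ∸ k) !) pr (≡.subst (p ∣_) (≡.sym pCk*denom≡p!) p∣p!)
  where
  instance _ = k ℕ.!* (p ∸ k) !≢0
  pCk*denom≡p! : (p C k) ℕ.* (k ! ℕ.* (p ∸ k) !) ≡ p !
  pCk*denom≡p! = ≡.trans (≡.cong (ℕ._* (k ! ℕ.* (p ∸ k) !)) (nCk≡n!/k![n-k]! (ℕ.<⇒≤ k<p)))
                         (m/n*n≡m (k![n∸k]!∣n! (ℕ.<⇒≤ k<p)))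
  p∣p! : p ∣ p !
  p∣p! = n∣n! p (ℕ.<-≤-trans 1≤k (ℕ.<⇒≤ k<p))
... | inj₁ p∣pCk = p∣pCk
... | inj₂ p∣denom with euclidsLemma (k !) ((p ∸ k) !) pr p∣denom
...   | inj₁ p∣k!   = ⊥-elim (prime∤m! pr k k<p p∣k!)
...   | inj₂ p∣p-k! = ⊥-elim (prime∤m! pr (p ∸ k) (ℕ.∸-monoʳ-< 1≤k (ℕ.<⇒≤ k<p)) p∣p-k!)

[m+n]%d≡m%d⇒d∣n : ∀ m n d .{{_ : NonZero d}} → (m ℕ.+ n) % d ≡ m % d → d ∣ n
[m+n]%d≡m%d⇒d∣n m n d eq = ∣m+n∣m⇒∣n d∣[m/d]d+n (n∣m*n (m / d))
  where
  open ≡.≡-Reasoning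
  [m/d]d+n≡[m+n/d]d : m / d ℕ.* d ℕ.+ n ≡ (m ℕ.+ n) / d ℕ.* d
  [m/d]d+n≡[m+n/d]d = ℕ.+-cancelˡ-≡ (m % d) _ _ (begin
    m % d ℕ.+ (m / d ℕ.* d ℕ.+ n)         ≡⟨ ℕ.+-assoc (m % d) _ n ⟨
    m % d ℕ.+ m / d ℕ.* d ℕ.+ n           ≡⟨ ≡.cong (ℕ._+ n) (m≡m%n+[m/n]*n m d) ⟨
    m ℕ.+ n                               ≡⟨ m≡m%n+[m/n]*n (m ℕ.+ n) d ⟩
    (m ℕ.+ n) % d ℕ.+ (m ℕ.+ n) / d ℕ.* d ≡⟨ ≡.cong (ℕ._+ (m ℕ.+ n) / d ℕ.* d) eq ⟩
    m % d ℕ.+ (m ℕ.+ n) / d ℕ.* d         ∎)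
  d∣[m/d]d+n : d ∣ m / d ℕ.* d ℕ.+ n
  d∣[m/d]d+n = ≡.subst (d ∣_) (≡.sym [m/d]d+n≡[m+n/d]d) (n∣m*n ((m ℕ.+ n) / d))

coprime⇒inverse-mod : ∀ {s Q} → 1 ≤ s → gcd s Q ≡ 1 → ∃₂ λ t k → t ℕ.* s ≡ suc (k ℕ.* Q)
coprime⇒inverse-mod {s} {Q} 1≤s gcd≡1 with coprime-Bézout (gcd≡1⇒coprime gcd≡1)
... | Bézout.+- t k 1+kQ≡ts = t , k , ≡.sym 1+kQ≡ts
... | Bézout.-+ x y 1+xs≡yQ = from-negative s Q 1≤s 1+xs≡yQ
  where
  open import Data.Nat.Solver using (module +-*-Solver)
  open +-*-Solver
  -- From 1 + x s = y Q, the number t = x (Q - 1) + Q ≡ -x (mod Q) works.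
  from-negative : ∀ s Q → 1 ≤ s → suc (x ℕ.* s) ≡ y ℕ.* Q → ∃₂ λ t k → t ℕ.* s ≡ suc (k ℕ.* Q)
  from-negative (suc s) zero    _ 1+xs≡0 = ⊥-elim (ℕ.1+n≢0 (≡.trans 1+xs≡0 (ℕ.*-zeroʳ y)))
  from-negative (suc s) (suc Q) _ 1+xs≡yQ =
    x ℕ.* Q ℕ.+ suc Q , Q ℕ.* y ℕ.+ s , ℕ.+-cancelʳ-≡ Q _ _ (begin
      (x ℕ.* Q ℕ.+ suc Q) ℕ.* suc s ℕ.+ Q
        ≡⟨ solve 3 (λ x Q s → (x :* Q :+ (con 1 :+ Q)) :* (con 1 :+ s) :+ Q
                               := Q :* (con 1 :+ x :* (con 1 :+ s)) :+ (con 1 :+ Q) :* (con 1 :+ s)) ≡.refl x Q s ⟩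
      Q ℕ.* suc (x ℕ.* suc s) ℕ.+ suc Q ℕ.* suc s
        ≡⟨ ≡.cong (λ m → Q ℕ.* m ℕ.+ suc Q ℕ.* suc s) 1+xs≡yQ ⟩
      Q ℕ.* (y ℕ.* suc Q) ℕ.+ suc Q ℕ.* suc s
        ≡⟨ solve 3 (λ y Q s → Q :* (y :* (con 1 :+ Q)) :+ (con 1 :+ Q) :* (con 1 :+ s)
                               := con 1 :+ (Q :* y :+ s) :* (con 1 :+ Q) :+ Q) ≡.refl y Q s ⟩
      suc ((Q ℕ.* y ℕ.+ s) ℕ.* suc Q) ℕ.+ Q
        ∎)
    where open ≡.≡-Reasoning

injective⇒surjective : ∀ {m} (f : Fin m → Fin m) → (∀ i j → f i ≡ f j → i ≡ j) → ∀ k → ∃ λ j → f j ≡ k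
injective⇒surjective {suc m} f f-inj k with any? (λ j → f j ≟ᶠ k)
... | yes hit  = hit
... | no ¬hit = ⊥-elim (ℕ.<⇒≱ (ℕ.n<1+n m) (injective⇒≤ g-inj))
  where
  g : Fin (suc m) → Fin m
  g j = punchOut {i = k} {j = f j} (λ k≡fj → ¬hit (j , ≡.sym k≡fj))
  g-inj : ∀ {i j} → g i ≡ g j → i ≡ j
  g-inj {i} {j} gi≡gj =
    f-inj i j (punchOut-injective {i = k} (λ k≡fi → ¬hit (i , ≡.sym k≡fi)) (λ k≡fj → ¬hit (j , ≡.sym k≡fj)) gi≡gj)

prime-5 : Prime 5
prime-5 = from-yes (prime? 5)

prime-power≡5⇒≡5 : ∀ {p n} → Prime p → p ^ n ≡ 5 → p ≡ 5
prime-power≡5⇒≡5 {p} {zero}  _       ()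
prime-power≡5⇒≡5 {p} {suc n} p-prime pⁿ⁺¹≡5 with prime⇒irreducible prime-5 p∣5
  where
  p∣5 : p ∣ 5
  p∣5 = divides (p ^ n) (≡.trans (≡.sym pⁿ⁺¹≡5) (ℕ.*-comm p (p ^ n)))
... | inj₁ p≡1 = ⊥-elim (ℕ.<⇒≢ (prime⇒2≤ p-prime) (≡.sym p≡1))
... | inj₂ p≡5 = p≡5

coprime-4⇒¬2∣ : ∀ {s} → gcd s 4 ≡ 1 → ¬ 2 ∣ s
coprime-4⇒¬2∣ gcd≡1 2∣s with ∣1⇒≡1 (≡.subst (2 ∣_) gcd≡1 (gcd-greatest 2∣s (divides 2 ≡.refl)))
... | ()


-- Finite sums and counting

χ : ∀ {a} {A : Set a} → Dec A → ℕ
χ (yes _) = 1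
χ (no _)  = 0

χ-yes : ∀ {a} {A : Set a} (A? : Dec A) → A → χ A? ≡ 1
χ-yes (yes _) _ = ≡.refl
χ-yes (no ¬a) a = ⊥-elim (¬a a)

χ-no : ∀ {a} {A : Set a} (A? : Dec A) → ¬ A → χ A? ≡ 0
χ-no (yes a) ¬a = ⊥-elim (¬a a)
χ-no (no _)  _  = ≡.refl

χ-cong : ∀ {a b} {A : Set a} {B : Set b} → (A → B) → (B → A) → (A? : Dec A) (B? : Dec B) → χ A? ≡ χ B?
χ-cong f g (yes a) (yes b) = ≡.refl
χ-cong f g (yes a) (no ¬b) = ⊥-elim (¬b (f a))
χ-cong f g (no ¬a) (yes b) = ⊥-elim (¬a (g b))
χ-cong f g (no ¬a) (no ¬b) = ≡.refl

module SumProperties {a b} (M : CommutativeMonoid a b) where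
  open CommutativeMonoid M
  open import Algebra.Properties.CommutativeMonoid.Sum M public using (sum; sum-permute; ∑-comm; ∑-distrib-+)
  open import Algebra.Properties.Monoid.Sum monoid public using (sum-cong-≋; sum-replicate; sum-replicate-zero)
  open import Algebra.Properties.CommutativeSemigroup commutativeSemigroup using (x∙yz≈y∙xz)
  open import Algebra.Properties.Monoid.Mult monoid public using () renaming (_×_ to _×ᴹ_)
  open import Relation.Binary.Reasoning.Setoid setoid

  sum-all-but-one : ∀ {n} (j : Fin n) (f : Fin n → Carrier) {x y} →
                    f j ≈ x → (∀ i → ¬ i ≡ j → f i ≈ y) → y ∙ sum f ≈ x ∙ (n ×ᴹ y)
  sum-all-but-one {suc n} fzero f {x} {y} fj≈x f≈y = begin
    y ∙ (f fzero ∙ sum (λ i → f (fsuc i)))  ≈⟨ ∙-congˡ (∙-cong fj≈x (sum-cong-≋ (λ i → f≈y (fsuc i) λ ()))) ⟩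
    y ∙ (x ∙ sum (λ (_ : Fin n) → y))       ≈⟨ ∙-congˡ (∙-congˡ (sum-replicate n)) ⟩
    y ∙ (x ∙ n ×ᴹ y)                        ≈⟨ x∙yz≈y∙xz y x _ ⟩
    x ∙ (y ∙ n ×ᴹ y)                        ∎
  sum-all-but-one {suc n} (fsuc j) f {x} {y} fj≈x f≈y = begin
    y ∙ (f fzero ∙ sum (λ i → f (fsuc i)))  ≈⟨ ∙-congˡ (∙-congʳ (f≈y fzero λ ())) ⟩
    y ∙ (y ∙ sum (λ i → f (fsuc i)))        ≈⟨ ∙-congˡ (sum-all-but-one j (λ i → f (fsuc i)) fj≈x
                                                 (λ i i≢j → f≈y (fsuc i) (λ eq → i≢j (suc-injective eq)))) ⟩
    y ∙ (x ∙ n ×ᴹ y)                        ≈⟨ x∙yz≈y∙xz y x _ ⟩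
    x ∙ (y ∙ n ×ᴹ y)                        ∎

  sum-single : ∀ {n} (j : Fin n) (f : Fin n → Carrier) → (∀ i → ¬ i ≡ j → f i ≈ ε) → sum f ≈ f j
  sum-single {n} j f f≈ε = begin
    sum f                ≈⟨ identityˡ (sum f) ⟨
    ε ∙ sum f            ≈⟨ sum-all-but-one j f refl f≈ε ⟩
    f j ∙ (n ×ᴹ ε)       ≈⟨ ∙-congˡ (trans (sym (sum-replicate n)) (sum-replicate-zero n)) ⟩
    f j ∙ ε              ≈⟨ identityʳ (f j) ⟩
    f j                  ∎

module ℕΣ = SumProperties ℕ.+-0-commutativeMonoid
module ℤΣ = SumProperties ℤ.+-0-commutativeMonoid

sum-pos : ∀ {m} (f : Fin m → ℕ) → ℤΣ.sum (λ k → + f k) ≡ + ℕΣ.sum f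
sum-pos {zero}  f = ≡.refl
sum-pos {suc m} f =
  ≡.trans (≡.cong (λ z → + f fzero ℤ.+ z) (sum-pos (λ k → f (fsuc k)))) (≡.sym (ℤ.pos-+ (f fzero) _))

sum-pos-sub : ∀ {k} (f g : Fin k → ℕ) → ℤΣ.sum (λ x → + f x ℤ.- + g x) ≡ + ℕΣ.sum f ℤ.- + ℕΣ.sum g
sum-pos-sub {zero}  f g = ≡.refl
sum-pos-sub {suc k} f g =
  ≡.trans (≡.cong (λ z → (+ f fzero ℤ.- + g fzero) ℤ.+ z) (sum-pos-sub (λ x → f (fsuc x)) (λ x → g (fsuc x))))
          (solve 4 (λ a b c d → (a :- b) :+ (c :- d) := (a :+ c) :- (b :+ d)) ≡.refl
                 (+ f fzero) (+ g fzero) (+ ℕΣ.sum (λ x → f (fsuc x))) (+ ℕΣ.sum (λ x → g (fsuc x))))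
  where
  open import Data.Integer.Solver using (module +-*-Solver)
  open +-*-Solver

sum-ones : ∀ n → ℕΣ.sum (λ (_ : Fin n) → 1) ≡ n
sum-ones zero    = ≡.refl
sum-ones (suc n) = ≡.cong suc (sum-ones n)

sum-χ≢0⇒∃ : ∀ {n p} {P : Fin n → Set p} (P? : Decidable P) →
             ¬ ℕΣ.sum (λ i → χ (P? i)) ≡ 0 → ∃ P
sum-χ≢0⇒∃ {zero}  P? sum≢0 = ⊥-elim (sum≢0 ≡.refl)
sum-χ≢0⇒∃ {suc n} P? sum≢0 with P? fzero
... | yes P0 = fzero , P0
... | no _   with sum-χ≢0⇒∃ (λ i → P? (fsuc i)) sum≢0
...   | i , Pᵢ = fsuc i , Pᵢ

length-filter≡sum-χ : ∀ {a p} {A : Set a} {P : A → Set p} (P? : Decidable P) {n} (f : Fin n → A) →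
                      length (filter P? (tabulate f)) ≡ ℕΣ.sum (λ i → χ (P? (f i)))
length-filter≡sum-χ P? {zero}  f = ≡.refl
length-filter≡sum-χ P? {suc n} f with P? (f fzero)
... | yes _ = ≡.cong suc (length-filter≡sum-χ P? (λ i → f (fsuc i)))
... | no _  = length-filter≡sum-χ P? (λ i → f (fsuc i))

foldr-tabulate≡sum : ∀ {m} (f : Fin m → ℤ) → foldr ℤ._+_ (+ 0) (tabulate f) ≡ ℤΣ.sum f
foldr-tabulate≡sum {zero}  f = ≡.refl
foldr-tabulate≡sum {suc m} f = ≡.cong (λ z → f fzero ℤ.+ z) (foldr-tabulate≡sum (λ i → f (fsuc i)))

foldr-allFin-single : ∀ {m} (f : Fin m → ℤ) j → (∀ i → ¬ i ≡ j → f i ≡ + 0) →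
                      foldr ℤ._+_ (+ 0) (map f (allFinL m)) ≡ f j
foldr-allFin-single f j f≡0 = ≡.trans (≡.cong (foldr ℤ._+_ (+ 0)) (map-tabulate (λ i → i) f))
                                (≡.trans (foldr-tabulate≡sum f) (ℤΣ.sum-single j f f≡0))


-- Finite fields

module FieldProperties {c ℓ : Level} (K : FiniteField c ℓ) where
  open FiniteField K
  open import Relation.Binary.Reasoning.Setoid setoid
  open import Algebra.Properties.Semiring.Exp semiring using (^-homo-*; ^-assocʳ) renaming (_^_ to _^ᴷ_)
  open import Algebra.Properties.CommutativeSemiring.Exp commutativeSemiring using (^-distrib-*)
  open import Algebra.Properties.Semiring.Mult semiring using (×-homo-+; ×1-homo-*) renaming (_×_ to _×ᴷ_)
  open import Algebra.Properties.Monoid.Sum +-monoid using (sum; sum-init-last; sum-cong-≋; sum-replicate-zero)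
  open import Algebra.Properties.CommutativeSemiring.Binomial commutativeSemiring using (binomialTerm; theorem)
  open import Algebra.Properties.Ring ring using (-‿distribˡ-*; -‿distribʳ-*)
  open import Algebra.Properties.Group +-group using (⁻¹-involutive)

  pow≡^ : ∀ x n → pow K x n ≡ x ^ᴷ n
  pow≡^ x zero    = ≡.refl
  pow≡^ x (suc n) = ≡.cong (x *_) (pow≡^ x n)

  pow-cong : ∀ n {x y} → x ≈ y → pow K x n ≈ pow K y n
  pow-cong zero    x≈y = refl
  pow-cong (suc n) x≈y = *-cong x≈y (pow-cong n x≈y)

  pow-+ : ∀ x m n → pow K x (m ℕ.+ n) ≈ pow K x m * pow K x n
  pow-+ x m n = begin
    pow K x (m ℕ.+ n)      ≡⟨ pow≡^ x (m ℕ.+ n) ⟩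
    x ^ᴷ (m ℕ.+ n)         ≈⟨ ^-homo-* x m n ⟩
    x ^ᴷ m * x ^ᴷ n        ≡⟨ ≡.sym (≡.cong₂ _*_ (pow≡^ x m) (pow≡^ x n)) ⟩
    pow K x m * pow K x n  ∎

  pow-* : ∀ x m n → pow K x (m ℕ.* n) ≈ pow K (pow K x m) n
  pow-* x m n = begin
    pow K x (m ℕ.* n)      ≡⟨ pow≡^ x (m ℕ.* n) ⟩
    x ^ᴷ (m ℕ.* n)         ≈⟨ ^-assocʳ x m n ⟨
    (x ^ᴷ m) ^ᴷ n          ≡⟨ ≡.sym (≡.trans (pow≡^ (pow K x m) n) (≡.cong (_^ᴷ n) (pow≡^ x m))) ⟩
    pow K (pow K x m) n    ∎

  pow-distrib-* : ∀ x y n → pow K (x * y) n ≈ pow K x n * pow K y n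
  pow-distrib-* x y n = begin
    pow K (x * y) n        ≡⟨ pow≡^ (x * y) n ⟩
    (x * y) ^ᴷ n           ≈⟨ ^-distrib-* x y n ⟩
    x ^ᴷ n * y ^ᴷ n        ≡⟨ ≡.sym (≡.cong₂ _*_ (pow≡^ x n) (pow≡^ y n)) ⟩
    pow K x n * pow K y n  ∎

  pow-1# : ∀ n → pow K 1# n ≈ 1#
  pow-1# zero    = refl
  pow-1# (suc n) = trans (*-identityˡ _) (pow-1# n)

  pow-0# : ∀ {n} → 1 ≤ n → pow K 0# n ≈ 0#
  pow-0# {suc n} _ = zeroˡ _

  ι≡×1# : ∀ n → ι K n ≡ n ×ᴷ 1#
  ι≡×1# zero    = ≡.refl
  ι≡×1# (suc n) = ≡.cong (λ z → 1# + z) (ι≡×1# n)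

  ι-+ : ∀ m n → ι K (m ℕ.+ n) ≈ ι K m + ι K n
  ι-+ m n = begin
    ι K (m ℕ.+ n)      ≡⟨ ι≡×1# (m ℕ.+ n) ⟩
    (m ℕ.+ n) ×ᴷ 1#    ≈⟨ ×-homo-+ 1# m n ⟩
    m ×ᴷ 1# + n ×ᴷ 1#  ≡⟨ ≡.sym (≡.cong₂ _+_ (ι≡×1# m) (ι≡×1# n)) ⟩
    ι K m + ι K n      ∎

  ι-* : ∀ m n → ι K (m ℕ.* n) ≈ ι K m * ι K n
  ι-* m n = begin
    ι K (m ℕ.* n)      ≡⟨ ι≡×1# (m ℕ.* n) ⟩
    (m ℕ.* n) ×ᴷ 1#    ≈⟨ ×1-homo-* m n ⟩
    m ×ᴷ 1# * n ×ᴷ 1#  ≡⟨ ≡.sym (≡.cong₂ _*_ (ι≡×1# m) (ι≡×1# n)) ⟩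
    ι K m * ι K n      ∎

  ×ᴷ≈ι* : ∀ n x → n ×ᴷ x ≈ ι K n * x
  ×ᴷ≈ι* zero    x = sym (zeroˡ x)
  ×ᴷ≈ι* (suc n) x = begin
    x + n ×ᴷ x           ≈⟨ +-cong (sym (*-identityˡ x)) (×ᴷ≈ι* n x) ⟩
    1# * x + ι K n * x   ≈⟨ distribʳ x 1# (ι K n) ⟨
    (1# + ι K n) * x     ∎

  ι-*-≈0 : ∀ k m → ι K m ≈ 0# → ι K (k ℕ.* m) ≈ 0#
  ι-*-≈0 k m ιm≈0 = trans (ι-* k m) (trans (*-congˡ ιm≈0) (zeroʳ _))

  ι-∣ : ∀ {m n} → m ∣ n → ι K m ≈ 0# → ι K n ≈ 0#
  ι-∣ {m} (divides k ≡.refl) ιm≈0 = ι-*-≈0 k m ιm≈0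

  ι-suc≉0 : ∀ m {n} → suc m ≡ n → ι K m ≈ 0# → ¬ ι K n ≈ 0#
  ι-suc≉0 m ≡.refl ιm≈0 ι1+m≈0 = 1≉0 (trans (sym (trans (+-congˡ ιm≈0) (+-identityʳ 1#))) ι1+m≈0)

  *-cancelˡ-≉0 : ∀ {a x y} → ¬ a ≈ 0# → a * x ≈ a * y → x ≈ y
  *-cancelˡ-≉0 {a} {x} {y} a≉0 ax≈ay = begin
    x               ≈⟨ *-identityˡ x ⟨
    1# * x          ≈⟨ *-congʳ (trans (*-comm b a) ab≈1) ⟨
    (b * a) * x     ≈⟨ *-assoc b a x ⟩
    b * (a * x)     ≈⟨ *-congˡ ax≈ay ⟩
    b * (a * y)     ≈⟨ *-assoc b a y ⟨
    (b * a) * y     ≈⟨ *-congʳ (trans (*-comm b a) ab≈1) ⟩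
    1# * y          ≈⟨ *-identityˡ y ⟩
    y               ∎
    where
    b = proj₁ (inverse a a≉0)
    ab≈1 = proj₂ (inverse a a≉0)

  *-≉0 : ∀ {x y} → ¬ x ≈ 0# → ¬ y ≈ 0# → ¬ x * y ≈ 0#
  *-≉0 {x} x≉0 y≉0 xy≈0 = y≉0 (*-cancelˡ-≉0 x≉0 (trans xy≈0 (sym (zeroʳ x))))

  pow-≉0 : ∀ {x} n → ¬ x ≈ 0# → ¬ pow K x n ≈ 0#
  pow-≉0 zero    x≉0 = 1≉0
  pow-≉0 (suc n) x≉0 = *-≉0 x≉0 (pow-≉0 n x≉0)

  -x*-x*y≈x*x*y : ∀ x y → (- x) * ((- x) * y) ≈ x * (x * y)
  -x*-x*y≈x*x*y x y = begin
    (- x) * ((- x) * y)     ≈⟨ -‿distribˡ-* x _ ⟨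
    - (x * ((- x) * y))     ≈⟨ -‿cong (*-congˡ (-‿distribˡ-* x y)) ⟨
    - (x * - (x * y))       ≈⟨ -‿cong (-‿distribʳ-* x (x * y)) ⟨
    - - (x * (x * y))       ≈⟨ ⁻¹-involutive _ ⟩
    x * (x * y)             ∎

  pow-neg-odd : ∀ {s} → ¬ 2 ∣ s → ∀ x → pow K (- x) s ≈ - pow K x s
  pow-neg-odd {zero}        2∤0 x = ⊥-elim (2∤0 (divides 0 ≡.refl))
  pow-neg-odd {suc zero}    _   x = trans (*-identityʳ (- x)) (-‿cong (sym (*-identityʳ x)))
  pow-neg-odd {suc (suc s)} 2∤s+2 x = begin
    (- x) * ((- x) * pow K (- x) s)   ≈⟨ -x*-x*y≈x*x*y x _ ⟩
    x * (x * pow K (- x) s)           ≈⟨ *-congˡ (*-congˡ (pow-neg-odd (λ 2∣s → 2∤s+2 (∣m∣n⇒∣m+n ∣-refl 2∣s)) x)) ⟩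
    x * (x * - pow K x s)             ≈⟨ *-congˡ (-‿distribʳ-* x _) ⟨
    x * - (x * pow K x s)             ≈⟨ -‿distribʳ-* x _ ⟨
    - (x * (x * pow K x s))           ∎

  frobenius : ∀ {p} → Prime p → ι K p ≈ 0# → ∀ x y → pow K (x + y) p ≈ pow K x p + pow K y p
  frobenius {zero}  p-prime _ = ⊥-elim (ℕ.≤⇒≯ z≤n (prime⇒2≤ p-prime))
  frobenius {suc m} p-prime char-p x y = begin
    pow K (x + y) p
      ≡⟨ pow≡^ (x + y) p ⟩
    (x + y) ^ᴷ p
      ≈⟨ theorem p x y ⟩
    term fzero + sum (λ i → term (fsuc i))
      ≈⟨ +-congˡ (sum-init-last (λ i → term (fsuc i))) ⟩
    term fzero + (sum (λ i → term (fsuc (inject₁ i))) + term (fsuc (fromℕ m)))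
      ≈⟨ +-congˡ (+-congʳ (trans (sum-cong-≋ middle≈0) (sum-replicate-zero m))) ⟩
    term fzero + (0# + term (fsuc (fromℕ m)))
      ≈⟨ +-cong first (trans (+-identityˡ _) last) ⟩
    pow K y p + pow K x p
      ≈⟨ +-comm _ _ ⟩
    pow K x p + pow K y p
      ∎
    where
    p = suc m
    term = binomialTerm x y p
    first : term fzero ≈ pow K y p
    first = begin
      1 ×ᴷ (1# * y ^ᴷ p)  ≈⟨ +-identityʳ _ ⟩
      1# * y ^ᴷ p         ≈⟨ *-identityˡ _ ⟩
      y ^ᴷ p              ≡⟨ ≡.sym (pow≡^ y p) ⟩
      pow K y p           ∎
    last : term (fsuc (fromℕ m)) ≈ pow K x p
    last rewrite toℕ-fromℕ m | nCn≡1 (suc m) | ℕ.n∸n≡0 m = begin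
      1 ×ᴷ (x ^ᴷ p * 1#)  ≈⟨ +-identityʳ _ ⟩
      x ^ᴷ p * 1#         ≈⟨ *-identityʳ _ ⟩
      x ^ᴷ p              ≡⟨ ≡.sym (pow≡^ x p) ⟩
      pow K x p           ∎
    middle≈0 : ∀ i → term (fsuc (inject₁ i)) ≈ 0#
    middle≈0 i = begin
      term (fsuc (inject₁ i))                 ≈⟨ ×ᴷ≈ι* (p C suc (toℕ (inject₁ i))) _ ⟩
      ι K (p C suc (toℕ (inject₁ i))) * _     ≈⟨ *-congʳ (ι-∣ (prime∣pCk p-prime _ (s≤s z≤n) k<p) char-p) ⟩
      0# * _                                  ≈⟨ zeroˡ _ ⟩
      0#                                      ∎
      where
      k<p : suc (toℕ (inject₁ i)) < p
      k<p rewrite toℕ-inject₁ i = s≤s (toℕ<n i)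

module Characteristic {c ℓ : Level} (K : FiniteField c ℓ) {p : ℕ} (p-prime : Prime p)
                      (char-p : FiniteField._≈_ K (ι K p) (FiniteField.0# K)) where
  open FiniteField K
  open FieldProperties K
  open import Relation.Binary.Reasoning.Setoid setoid
  open import Algebra.Properties.CommutativeSemigroup +-commutativeSemigroup using (interchange)
  open import Algebra.Properties.Ring ring using (x+x≈x⇒x≈0)
  open import Algebra.Properties.Group +-group using (inverseˡ-unique)
  open import Data.Nat.Coprimality using (prime⇒coprime)

  frobenius-^ : ∀ i x y → pow K (x + y) (p ^ i) ≈ pow K x (p ^ i) + pow K y (p ^ i)
  frobenius-^ zero x y = trans (*-identityʳ _) (sym (+-cong (*-identityʳ x) (*-identityʳ y)))
  frobenius-^ (suc i) x y = begin
    pow K (x + y) (p ℕ.* p ^ i)                            ≈⟨ pow-* (x + y) p (p ^ i) ⟩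
    pow K (pow K (x + y) p) (p ^ i)                        ≈⟨ pow-cong (p ^ i) (frobenius p-prime char-p x y) ⟩
    pow K (pow K x p + pow K y p) (p ^ i)                  ≈⟨ frobenius-^ i _ _ ⟩
    pow K (pow K x p) (p ^ i) + pow K (pow K y p) (p ^ i)  ≈⟨ +-cong (pow-* x p (p ^ i)) (pow-* y p (p ^ i)) ⟨
    pow K x (p ℕ.* p ^ i) + pow K y (p ℕ.* p ^ i)          ∎

  pow-p-fixed⇒pow-^-fixed : ∀ {x} → pow K x p ≈ x → ∀ i → pow K x (p ^ i) ≈ x
  pow-p-fixed⇒pow-^-fixed {x} xᵖ≈x zero    = *-identityʳ x
  pow-p-fixed⇒pow-^-fixed {x} xᵖ≈x (suc i) =
    trans (pow-* x p (p ^ i)) (trans (pow-cong (p ^ i) xᵖ≈x) (pow-p-fixed⇒pow-^-fixed xᵖ≈x i))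

  ι-fermat : ∀ a → pow K (ι K a) p ≈ ι K a
  ι-fermat zero    = pow-0# (ℕ.<-trans (s≤s z≤n) (prime⇒2≤ p-prime))
  ι-fermat (suc a) = trans (frobenius p-prime char-p 1# (ι K a)) (+-cong (pow-1# p) (ι-fermat a))

  ι-≉0 : ∀ {a} → 1 ≤ a → a < p → ¬ ι K a ≈ 0#
  ι-≉0 {a} 1≤a a<p ιa≈0 with coprime-Bézout (prime⇒coprime p-prime {{ℕ.>-nonZero 1≤a}} a<p)
  ... | Bézout.+- x y 1+ya≡xp = ι-suc≉0 (y ℕ.* a) 1+ya≡xp (ι-*-≈0 y a ιa≈0) (ι-*-≈0 x p char-p)
  ... | Bézout.-+ x y 1+xp≡ya = ι-suc≉0 (x ℕ.* p) 1+xp≡ya (ι-*-≈0 x p char-p) (ι-*-≈0 y a ιa≈0)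

  ι-% : ∀ m .{{_ : NonZero p}} → ι K (m % p) ≈ ι K m
  ι-% m = begin
    ι K (m % p)                         ≈⟨ +-identityʳ _ ⟨
    ι K (m % p) + 0#                    ≈⟨ +-congˡ (ι-*-≈0 (m / p) p char-p) ⟨
    ι K (m % p) + ι K (m / p ℕ.* p)     ≈⟨ ι-+ (m % p) _ ⟨
    ι K (m % p ℕ.+ m / p ℕ.* p)         ≡⟨ ≡.cong (ι K) (m≡m%n+[m/n]*n m p) ⟨
    ι K m                               ∎

  Tr-cong : ∀ n {x y} → x ≈ y → Tr K p n x ≈ Tr K p n y
  Tr-cong zero    x≈y = refl
  Tr-cong (suc n) x≈y = +-cong (pow-cong (p ^ n) x≈y) (Tr-cong n x≈y)

  Tr-+ : ∀ n x y → Tr K p n (x + y) ≈ Tr K p n x + Tr K p n y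
  Tr-+ zero    x y = sym (+-identityˡ 0#)
  Tr-+ (suc n) x y = trans (+-cong (frobenius-^ n x y) (Tr-+ n x y)) (interchange _ _ _ _)

  Tr-0# : ∀ n → Tr K p n 0# ≈ 0#
  Tr-0# n = x+x≈x⇒x≈0 _ (trans (sym (Tr-+ n 0# 0#)) (Tr-cong n (+-identityˡ 0#)))

  Tr-neg : ∀ n x → Tr K p n (- x) ≈ - Tr K p n x
  Tr-neg n x =
    inverseˡ-unique _ _ (trans (sym (Tr-+ n (- x) x)) (trans (Tr-cong n (-‿inverseˡ x)) (Tr-0# n)))

  Tr-*-fixed : ∀ n {a} → pow K a p ≈ a → ∀ x → Tr K p n (a * x) ≈ a * Tr K p n x
  Tr-*-fixed zero    aᵖ≈a x = sym (zeroʳ _)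
  Tr-*-fixed (suc n) {a} aᵖ≈a x = begin
    pow K (a * x) (p ^ n) + Tr K p n (a * x)            ≈⟨ +-cong (pow-distrib-* a x (p ^ n)) (Tr-*-fixed n aᵖ≈a x) ⟩
    pow K a (p ^ n) * pow K x (p ^ n) + a * Tr K p n x  ≈⟨ +-congʳ (*-congʳ (pow-p-fixed⇒pow-^-fixed aᵖ≈a n)) ⟩
    a * pow K x (p ^ n) + a * Tr K p n x                ≈⟨ distribˡ a _ _ ⟨
    a * (pow K x (p ^ n) + Tr K p n x)                  ∎

module SumOverField {c ℓ : Level} (K : FiniteField c ℓ) where
  open FiniteField K
  open FieldProperties K using (*-cancelˡ-≉0)
  open import Function.Consequences.Setoid setoid setoid using (strictlyInverseˡ⇒inverseˡ; strictlyInverseʳ⇒inverseʳ)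
  open import Algebra.Properties.Group +-group using (⁻¹-involutive; ⁻¹-injective; ∙-cancelʳ)

  index : Carrier → Fin order
  index x = proj₁ (enum-surj x)

  enum-index : ∀ x → enum (index x) ≈ x
  enum-index x = proj₂ (enum-surj x)

  enum≈0⇒≡index0 : ∀ {i} → enum i ≈ 0# → i ≡ index 0#
  enum≈0⇒≡index0 {i} eᵢ≈0 = enum-inj _ _ (trans eᵢ≈0 (sym (enum-index 0#)))

  K↔K : Set _
  K↔K = Inverse setoid setoid

  mk↔ : (f g : Carrier → Carrier) → (∀ {x y} → x ≈ y → f x ≈ f y) → (∀ {x y} → x ≈ y → g x ≈ g y) →
        (∀ x → f (g x) ≈ x) → (∀ x → g (f x) ≈ x) → K↔K
  mk↔ f g f-cong g-cong fg≈id gf≈id = record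
    { to        = f
    ; from      = g
    ; to-cong   = f-cong
    ; from-cong = g-cong
    ; inverse   = strictlyInverseˡ⇒inverseˡ f-cong fg≈id , strictlyInverseʳ⇒inverseʳ g-cong gf≈id
    }

  *-↔ : ∀ {a} → ¬ a ≈ 0# → K↔K
  *-↔ {a} a≉0 = mk↔ (a *_) (b *_) *-congˡ *-congˡ (cancel ab≈1) (cancel (trans (*-comm b a) ab≈1))
    where
    b = proj₁ (inverse a a≉0)
    ab≈1 = proj₂ (inverse a a≉0)
    cancel : ∀ {u v} → u * v ≈ 1# → ∀ x → u * (v * x) ≈ x
    cancel uv≈1 x = trans (sym (*-assoc _ _ x)) (trans (*-congʳ uv≈1) (*-identityˡ x))

  +-↔ : Carrier → K↔K
  +-↔ b = mk↔ (_+ b) (_- b) +-congʳ +-congʳ (cancel (-‿inverseˡ b)) (cancel (-‿inverseʳ b))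
    where
    cancel : ∀ {u v} → v + u ≈ 0# → ∀ x → x + v + u ≈ x
    cancel vu≈0 x = trans (+-assoc x _ _) (trans (+-congˡ vu≈0) (+-identityʳ x))

  -‿↔ : K↔K
  -‿↔ = mk↔ -_ -_ -‿cong -‿cong ⁻¹-involutive ⁻¹-involutive

  module _ {a b} (M : CommutativeMonoid a b) where
    private module M = CommutativeMonoid M
    open SumProperties M

    ∑K : (Carrier → M.Carrier) → M.Carrier
    ∑K F = sum (λ i → F (enum i))

    ∑K-reindex : (π : K↔K) (F : Carrier → M.Carrier) → (∀ {x y} → x ≈ y → F x M.≈ F y) →
                 ∑K F M.≈ ∑K (λ x → F (Inverse.to π x))
    ∑K-reindex π F F-cong =
      M.trans (sum-permute (λ i → F (enum i)) perm) (sum-cong-≋ (λ i → F-cong (enum-index (to (enum i)))))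
      where
      open Inverse π
      perm = permutation (λ i → index (to (enum i))) (λ i → index (from (enum i)))
        (λ i → enum-inj _ _ (trans (enum-index _) (trans (to-cong (enum-index _)) (strictlyInverseˡ (enum i)))))
        (λ i → enum-inj _ _ (trans (enum-index _) (trans (from-cong (enum-index _)) (strictlyInverseʳ (enum i)))))

  1≤order : 1 ≤ order
  1≤order = ℕ.>-nonZero⁻¹ order {{nonZeroIndex (index 0#)}}

  ∑ℕ : (Carrier → ℕ) → ℕ
  ∑ℕ = ∑K ℕ.+-0-commutativeMonoid

  ∑ℤ : (Carrier → ℤ) → ℤ
  ∑ℤ = ∑K ℤ.+-0-commutativeMonoid

  #fiber : (Carrier → Carrier) → Carrier → ℕ
  #fiber f y = ∑ℕ (λ x → χ (f x ≟ y))

  χ-≈ : ∀ {x x′ y y′} → x ≈ x′ → y ≈ y′ → χ (x ≟ y) ≡ χ (x′ ≟ y′)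
  χ-≈ x≈x′ y≈y′ = χ-cong (λ x≈y → trans (sym x≈x′) (trans x≈y y≈y′))
                         (λ x′≈y′ → trans x≈x′ (trans x′≈y′ (sym y≈y′))) _ _

  #fiber-cong : ∀ {f g : Carrier → Carrier} {y y′} → (∀ x → f x ≈ g x) → y ≈ y′ → #fiber f y ≡ #fiber g y′
  #fiber-cong f≈g y≈y′ = ℕΣ.sum-cong-≋ (λ i → χ-≈ (f≈g (enum i)) y≈y′)

  #fiber-reindex : ∀ (π : K↔K) {f : Carrier → Carrier} → (∀ {x x′} → x ≈ x′ → f x ≈ f x′) →
                   ∀ y → #fiber f y ≡ #fiber (λ x → f (Inverse.to π x)) y
  #fiber-reindex π f-cong y = ∑K-reindex ℕ.+-0-commutativeMonoid π _ (λ x≈x′ → χ-≈ (f-cong x≈x′) refl)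

  #fiber-* : ∀ {a} → ¬ a ≈ 0# → ∀ (f : Carrier → Carrier) y → #fiber (λ x → a * f x) (a * y) ≡ #fiber f y
  #fiber-* {a} a≉0 f y = ℕΣ.sum-cong-≋
    (λ i → χ-cong (*-cancelˡ-≉0 a≉0) *-congˡ ((a * f (enum i)) ≟ (a * y)) (f (enum i) ≟ y))

  #fiber-+ : ∀ b (f : Carrier → Carrier) y → #fiber (λ x → f x + b) (y + b) ≡ #fiber f y
  #fiber-+ b f y = ℕΣ.sum-cong-≋
    (λ i → χ-cong (∙-cancelʳ b _ _) +-congʳ ((f (enum i) + b) ≟ (y + b)) (f (enum i) ≟ y))

  #fiber-neg : ∀ (f : Carrier → Carrier) y → #fiber (λ x → - f x) (- y) ≡ #fiber f y
  #fiber-neg f y = ℕΣ.sum-cong-≋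
    (λ i → χ-cong ⁻¹-injective -‿cong ((- f (enum i)) ≟ (- y)) (f (enum i) ≟ y))

  #fiber-all : ∀ {f : Carrier → Carrier} {y} → (∀ x → f x ≈ y) → #fiber f y ≡ order
  #fiber-all {f} {y} f≈y =
    ≡.trans (ℕΣ.sum-cong-≋ (λ i → χ-yes (f (enum i) ≟ y) (f≈y (enum i)))) (sum-ones order)

  #fiber-none : ∀ {f : Carrier → Carrier} {y} → (∀ x → ¬ f x ≈ y) → #fiber f y ≡ 0
  #fiber-none {f} {y} f≉y =
    ≡.trans (ℕΣ.sum-cong-≋ (λ i → χ-no (f (enum i) ≟ y) (f≉y (enum i)))) (ℕΣ.sum-replicate-zero order)

  #fiber≢0⇒∃ : ∀ {f : Carrier → Carrier} {y} → ¬ #fiber f y ≡ 0 → ∃ λ x → f x ≈ y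
  #fiber≢0⇒∃ {f} {y} #≢0 with sum-χ≢0⇒∃ (λ i → f (enum i) ≟ y) #≢0
  ... | i , fᵢ≈y = enum i , fᵢ≈y

module Lagrange {c ℓ : Level} (K : FiniteField c ℓ) where
  open FiniteField K
  open FieldProperties K
  open SumOverField K
  open SumProperties *-commutativeMonoid
    using (sum; sum-cong-≋; ∑-distrib-+; sum-all-but-one) renaming (_×ᴹ_ to _×*_)
  open import Relation.Binary.Reasoning.Setoid setoid

  ∏K : (Carrier → Carrier) → Carrier
  ∏K = ∑K *-commutativeMonoid

  ×*≈pow : ∀ n x → n ×* x ≈ pow K x n
  ×*≈pow zero    x = refl
  ×*≈pow (suc n) x = *-congˡ (×*≈pow n x)

  product-≉0 : ∀ {n} (f : Fin n → Carrier) → (∀ i → ¬ f i ≈ 0#) → ¬ sum f ≈ 0#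
  product-≉0 {zero}  f f≉0 = 1≉0
  product-≉0 {suc n} f f≉0 = *-≉0 (f≉0 fzero) (product-≉0 (λ i → f (fsuc i)) (λ i → f≉0 (fsuc i)))

  orOne : Carrier → Carrier
  orOne z with z ≟ 0#
  ... | yes _ = 1#
  ... | no _  = z

  orOne-cong : ∀ {x y} → x ≈ y → orOne x ≈ orOne y
  orOne-cong {x} {y} x≈y with x ≟ 0# | y ≟ 0#
  ... | yes _   | yes _   = refl
  ... | yes x≈0 | no y≉0  = ⊥-elim (y≉0 (trans (sym x≈y) x≈0))
  ... | no x≉0  | yes y≈0 = ⊥-elim (x≉0 (trans x≈y y≈0))
  ... | no _    | no _    = x≈y

  orOne-≉0 : ∀ z → ¬ orOne z ≈ 0#
  orOne-≉0 z with z ≟ 0#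
  ... | yes _   = 1≉0
  ... | no z≉0  = z≉0

  -- Since z ↦ x z permutes K, ∏_z orOne (x z) = ∏_z orOne z; the left side is x^(q-1) ∏_z orOne z.
  module _ {x : Carrier} (x≉0 : ¬ x ≈ 0#) where
    xOr1 : Carrier → Carrier
    xOr1 z with z ≟ 0#
    ... | yes _ = 1#
    ... | no _  = x

    orOne-* : ∀ z → orOne (x * z) ≈ xOr1 z * orOne z
    orOne-* z with z ≟ 0# | (x * z) ≟ 0#
    ... | yes _   | yes _    = sym (*-identityˡ 1#)
    ... | yes z≈0 | no xz≉0  = ⊥-elim (xz≉0 (trans (*-congˡ z≈0) (zeroʳ x)))
    ... | no z≉0  | yes xz≈0 = ⊥-elim (*-≉0 x≉0 z≉0 xz≈0)
    ... | no _    | no _     = refl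

    ∏K-xOr1≈1 : ∏K xOr1 ≈ 1#
    ∏K-xOr1≈1 = *-cancelˡ-≉0 (product-≉0 _ (λ i → orOne-≉0 (enum i))) (begin
      P * ∏K xOr1                        ≈⟨ *-comm P _ ⟩
      ∏K xOr1 * P                        ≈⟨ ∑-distrib-+ (λ i → xOr1 (enum i)) (λ i → orOne (enum i)) ⟨
      ∏K (λ z → xOr1 z * orOne z)        ≈⟨ sum-cong-≋ (λ i → orOne-* (enum i)) ⟨
      ∏K (λ z → orOne (x * z))           ≈⟨ ∑K-reindex *-commutativeMonoid (*-↔ x≉0) orOne orOne-cong ⟨
      P                                  ≈⟨ *-identityʳ P ⟨
      P * 1#                             ∎)
      where P = ∏K orOne

    pow-order-≉0 : pow K x order ≈ x
    pow-order-≉0 = begin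
      pow K x order                      ≈⟨ ×*≈pow order x ⟨
      order ×* x                         ≈⟨ *-identityˡ _ ⟨
      1# * order ×* x                    ≈⟨ sum-all-but-one (index 0#) (λ i → xOr1 (enum i)) xOr1-0 xOr1-≉0 ⟨
      x * ∏K xOr1                        ≈⟨ *-congˡ ∏K-xOr1≈1 ⟩
      x * 1#                             ≈⟨ *-identityʳ x ⟩
      x                                  ∎
      where
      xOr1-0 : xOr1 (enum (index 0#)) ≈ 1#
      xOr1-0 with enum (index 0#) ≟ 0#
      ... | yes _  = refl
      ... | no e≉0 = ⊥-elim (e≉0 (enum-index 0#))
      xOr1-≉0 : ∀ i → ¬ i ≡ index 0# → xOr1 (enum i) ≈ x
      xOr1-≉0 i i≢0 with enum i ≟ 0#
      ... | yes eᵢ≈0 = ⊥-elim (i≢0 (enum≈0⇒≡index0 eᵢ≈0))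
      ... | no _     = refl

  pow-order : ∀ x → pow K x order ≈ x
  pow-order x with x ≟ 0#
  ... | no x≉0  = pow-order-≉0 x≉0
  ... | yes x≈0 = trans (pow-cong order x≈0) (trans (pow-0# 1≤order) (sym x≈0))

module Root {c ℓ : Level} (K : FiniteField c ℓ) {s : ℕ} (1≤s : 1 ≤ s)
            (s-coprime : gcd s (FiniteField.order K ∸ 1) ≡ 1) where
  open FiniteField K
  open FieldProperties K
  open SumOverField K
  open Lagrange K
  open import Relation.Binary.Reasoning.Setoid setoid

  private
    Q = order ∸ 1
    t = proj₁ (coprime⇒inverse-mod 1≤s s-coprime)
    k = proj₁ (proj₂ (coprime⇒inverse-mod 1≤s s-coprime))
    ts≡1+kQ : t ℕ.* s ≡ suc (k ℕ.* Q)
    ts≡1+kQ = proj₂ (proj₂ (coprime⇒inverse-mod 1≤s s-coprime))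

  pow-1+*Q : ∀ z m → pow K z (suc (m ℕ.* Q)) ≈ z
  pow-1+*Q z zero    = *-identityʳ z
  pow-1+*Q z (suc m) = begin
    pow K z (suc (Q ℕ.+ m ℕ.* Q))       ≡⟨ ≡.cong (pow K z) (ℕ.+-suc Q (m ℕ.* Q)) ⟨
    pow K z (Q ℕ.+ suc (m ℕ.* Q))       ≈⟨ pow-+ z Q _ ⟩
    pow K z Q * pow K z (suc (m ℕ.* Q)) ≈⟨ *-congˡ (pow-1+*Q z m) ⟩
    pow K z Q * z                       ≈⟨ *-comm _ z ⟩
    pow K z (suc Q)                     ≡⟨ ≡.cong (pow K z) (ℕ.suc-pred order {{ℕ.>-nonZero 1≤order}}) ⟩
    pow K z order                       ≈⟨ pow-order z ⟩
    z                                   ∎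

  root : Carrier → Carrier
  root z = pow K z t

  pow-root : ∀ z → pow K (root z) s ≈ z
  pow-root z = trans (sym (pow-* z t s)) (trans (reflexive (≡.cong (pow K z) ts≡1+kQ)) (pow-1+*Q z k))

  root-pow : ∀ z → root (pow K z s) ≈ z
  root-pow z =
    trans (sym (pow-* z s t)) (trans (reflexive (≡.cong (pow K z) (≡.trans (ℕ.*-comm s t) ts≡1+kQ))) (pow-1+*Q z k))

  pow-↔ : K↔K
  pow-↔ = mk↔ (λ z → pow K z s) root (pow-cong s) (pow-cong t) pow-root root-pow


-- The Galois action on coefficient vectors

module Cyclotomic (p : ℕ) .{{_ : NonZero p}} where
  open import Data.Integer.Solver using (module +-*-Solver)
  open +-*-Solver

  ≗⇒ZζEq : ∀ {a b : Fin p → ℤ} → a ≗ b → ZζEq a b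
  ≗⇒ZζEq a≗b = + 0 , λ j → ≡.trans (a≗b j) (≡.sym (ℤ.+-identityʳ _))

  ZζEq-refl : ∀ {a : Fin p → ℤ} → ZζEq a a
  ZζEq-refl {a} = ≗⇒ZζEq {a} {a} (λ _ → ≡.refl)

  ZζEq-sym : ∀ {a b : Fin p → ℤ} → ZζEq a b → ZζEq b a
  ZζEq-sym (c , a≡b+c) = ℤ.- c , λ j → ≡.sym (cancel (a≡b+c j))
    where
    cancel : ∀ {x y c} → x ≡ y ℤ.+ c → x ℤ.- c ≡ y
    cancel {y = y} {c} ≡.refl = solve 2 (λ y c → (y :+ c) :- c := y) ≡.refl y c

  ZζEq-trans : ∀ {a b d : Fin p → ℤ} → ZζEq a b → ZζEq b d → ZζEq a d
  ZζEq-trans {d = d} (c₁ , a≡b+c₁) (c₂ , b≡d+c₂) =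
    c₂ ℤ.+ c₁ , λ j → ≡.trans (a≡b+c₁ j) (≡.trans (≡.cong (ℤ._+ c₁) (b≡d+c₂ j)) (ℤ.+-assoc (d j) c₂ c₁))

  ZζEq-isEquivalence : IsEquivalence (ZζEq {p})
  ZζEq-isEquivalence = record
    { refl  = λ {a} → ZζEq-refl {a}
    ; sym   = λ {a} {b} → ZζEq-sym {a} {b}
    ; trans = λ {a} {b} {d} → ZζEq-trans {a} {b} {d}
    }

  ℤ[ζ] : Setoid 0ℓ 0ℓ
  ℤ[ζ] = record { isEquivalence = ZζEq-isEquivalence }

  0ᶠ : Fin p
  0ᶠ = fromℕ< (ℕ.>-nonZero⁻¹ p)

  toℕ-0ᶠ : toℕ 0ᶠ ≡ 0
  toℕ-0ᶠ = toℕ-fromℕ< _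

  -- The only possible constant is the difference of the coefficients at 0.
  ZζEq? : ∀ (a b : Fin p → ℤ) → Dec (ZζEq a b)
  ZζEq? a b with all? (λ j → a j ℤ.≟ b j ℤ.+ (a 0ᶠ ℤ.- b 0ᶠ))
  ... | yes a≡b+c = yes (_ , a≡b+c)
  ... | no ¬a≡b+c = no λ (c , a≡b+c) → ¬a≡b+c λ j → ≡.trans (a≡b+c j) (≡.cong (λ z → b j ℤ.+ z) (c≡ c a≡b+c))
    where
    c≡ : ∀ c → (∀ j → a j ≡ b j ℤ.+ c) → c ≡ a 0ᶠ ℤ.- b 0ᶠ
    c≡ c a≡b+c =
      ≡.trans (solve 2 (λ b c → c := (b :+ c) :- b) ≡.refl (b 0ᶠ) c) (≡.cong (ℤ._- b 0ᶠ) (≡.sym (a≡b+c 0ᶠ)))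

module GaloisAction (p γ : ℕ) .{{_ : NonZero p}} (p-prime : Prime p) (γ-generator : IsGenerator p γ) where
  open Cyclotomic p

  mulγ : Fin p → Fin p
  mulγ j = fromℕ< (m%n<n (γ ℕ.* toℕ j) p)

  toℕ-mulγ : ∀ j → toℕ (mulγ j) ≡ (γ ℕ.* toℕ j) % p
  toℕ-mulγ j = toℕ-fromℕ< _

  private
    mulγ-injective-≤ : ∀ i j → toℕ i ≤ toℕ j → mulγ i ≡ mulγ j → i ≡ j
    mulγ-injective-≤ i j i≤j eq = toℕ-injective (begin
      toℕ i           ≡⟨ ℕ.+-identityʳ (toℕ i) ⟨
      toℕ i ℕ.+ 0     ≡⟨ ≡.cong (toℕ i ℕ.+_) d≡0 ⟨
      toℕ i ℕ.+ d     ≡⟨ ℕ.m+[n∸m]≡n i≤j ⟩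
      toℕ j           ∎)
      where
      open ≡.≡-Reasoning
      d = toℕ j ℕ.∸ toℕ i
      γi+γd≡γj : γ ℕ.* toℕ i ℕ.+ γ ℕ.* d ≡ γ ℕ.* toℕ j
      γi+γd≡γj = ≡.trans (≡.sym (ℕ.*-distribˡ-+ γ (toℕ i) d)) (≡.cong (γ ℕ.*_) (ℕ.m+[n∸m]≡n i≤j))
      p∣γd : p ∣ γ ℕ.* d
      p∣γd = [m+n]%d≡m%d⇒d∣n _ _ p (begin
        (γ ℕ.* toℕ i ℕ.+ γ ℕ.* d) % p ≡⟨ ≡.cong (_% p) γi+γd≡γj ⟩
        (γ ℕ.* toℕ j) % p             ≡⟨ toℕ-mulγ j ⟨
        toℕ (mulγ j)                  ≡⟨ ≡.cong toℕ eq ⟨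
        toℕ (mulγ i)                  ≡⟨ toℕ-mulγ i ⟩
        (γ ℕ.* toℕ i) % p             ∎)
      d<p : d < p
      d<p = ℕ.≤-<-trans (ℕ.m∸n≤m (toℕ j) (toℕ i)) (toℕ<n j)
      d≡0 : d ≡ 0
      d≡0 with euclidsLemma γ d p-prime p∣γd
      ... | inj₁ p∣γ = ⊥-elim (>⇒∤ {{ℕ.>-nonZero (proj₁ γ-generator)}} (proj₁ (proj₂ γ-generator)) p∣γ)
      ... | inj₂ p∣d = ≡.trans (≡.sym (m<n⇒m%n≡m d<p)) (n∣m⇒m%n≡0 d p p∣d)

  mulγ-injective : ∀ i j → mulγ i ≡ mulγ j → i ≡ j
  mulγ-injective i j eq with ℕ.≤-total (toℕ i) (toℕ j)
  ... | inj₁ i≤j = mulγ-injective-≤ i j i≤j eq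
  ... | inj₂ j≤i = ≡.sym (mulγ-injective-≤ j i j≤i (≡.sym eq))

  mulγ-surjective : ∀ k → ∃ λ j → mulγ j ≡ k
  mulγ-surjective = injective⇒surjective mulγ mulγ-injective

  module _ (a : Fin p → ℤ) (j : Fin p) where
    -- The summands of σ use a selector local to Defs that cannot be named here,
    -- so the statements about them are left to unification.
    mutual
      σ-mulγ : σ p γ a (mulγ j) ≡ a j
      σ-mulγ = ≡.trans (foldr-allFin-single _ j summand≢j≡0) summand-j

      summand≢j≡0 : _
      summand≢j≡0 i i≢j with (γ ℕ.* toℕ i) % p ℕ.≟ toℕ (mulγ j)
      ... | yes eq = ⊥-elim (i≢j (mulγ-injective i j (toℕ-injective (≡.trans (toℕ-mulγ i) eq))))
      ... | no _   = ≡.refl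

      summand-j : _
      summand-j with (γ ℕ.* toℕ j) % p ℕ.≟ toℕ (mulγ j)
      ... | yes _ = ≡.refl
      ... | no ≢  = ⊥-elim (≢ (≡.sym (toℕ-mulγ j)))

  σ-≗ : ∀ {a b : Fin p → ℤ} → (∀ j → b (mulγ j) ≡ a j) → σ p γ a ≗ b
  σ-≗ {a} {b} b∘mulγ≗a k with mulγ-surjective k
  ... | j , ≡.refl = ≡.trans (σ-mulγ a j) (≡.sym (b∘mulγ≗a j))

  σ-cong : ∀ {a b : Fin p → ℤ} → a ≗ b → σ p γ a ≗ σ p γ b
  σ-cong {a} {b} a≗b = σ-≗ λ j → ≡.trans (σ-mulγ b j) (≡.sym (a≗b j))

  σ-ZζEq : ∀ {a b : Fin p → ℤ} → ZζEq a b → ZζEq (σ p γ a) (σ p γ b)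
  σ-ZζEq {a} {b} (c , a≡b+c) = c , σ-≗ λ j → ≡.trans (≡.cong (ℤ._+ c) (σ-mulγ b j)) (≡.sym (a≡b+c j))

  σ-ZζEq⁻¹ : ∀ {a b : Fin p → ℤ} → ZζEq (σ p γ a) (σ p γ b) → ZζEq a b
  σ-ZζEq⁻¹ {a} {b} (c , σa≡σb+c) =
    c , λ j → ≡.trans (≡.sym (σ-mulγ a j)) (≡.trans (σa≡σb+c (mulγ j)) (≡.cong (ℤ._+ c) (σ-mulγ b j)))

  mulγ-0ᶠ : mulγ 0ᶠ ≡ 0ᶠ
  mulγ-0ᶠ = toℕ-injective (begin
    toℕ (mulγ 0ᶠ)            ≡⟨ toℕ-mulγ 0ᶠ ⟩
    (γ ℕ.* toℕ 0ᶠ) % p       ≡⟨ ≡.cong (λ n → (γ ℕ.* n) % p) toℕ-0ᶠ ⟩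
    (γ ℕ.* 0) % p            ≡⟨ ≡.cong (_% p) (ℕ.*-zeroʳ γ) ⟩
    0 % p                    ≡⟨ m<n⇒m%n≡m (ℕ.>-nonZero⁻¹ p) ⟩
    0                        ≡⟨ toℕ-0ᶠ ⟨
    toℕ 0ᶠ                   ∎)
    where open ≡.≡-Reasoning

  σ-fixes-0-supported : ∀ {a : Fin p → ℤ} → (∀ j → ¬ j ≡ 0ᶠ → a j ≡ + 0) → σ p γ a ≗ a
  σ-fixes-0-supported {a} a≡0 = σ-≗ fixed
    where
    fixed : ∀ j → a (mulγ j) ≡ a j
    fixed j with j ≟ᶠ 0ᶠ
    ... | yes ≡.refl = ≡.cong a mulγ-0ᶠ
    ... | no j≢0     = ≡.trans (a≡0 (mulγ j) γj≢0) (≡.sym (a≡0 j j≢0))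
      where γj≢0 = λ γj≡0 → j≢0 (mulγ-injective j 0ᶠ (≡.trans γj≡0 (≡.sym mulγ-0ᶠ)))

negate : Fin 5 → Fin 5
negate 0F = 0F
negate 1F = 4F
negate 2F = 3F
negate 3F = 2F
negate 4F = 1F

mulγ²-negate : ∀ γ (γ-generator : IsGenerator 5 γ) →
               let open GaloisAction 5 γ prime-5 γ-generator in ∀ k → mulγ (mulγ (negate k)) ≡ k
mulγ²-negate 0 (() , _)
mulγ²-negate 1 (_ , _ , order≠1) = ⊥-elim (order≠1 1 (s≤s z≤n) (s≤s (s≤s z≤n)) ≡.refl)
mulγ²-negate 2 γ-generator = from-yes (all? λ k → mulγ (mulγ (negate k)) ≟ᶠ k)
  where open GaloisAction 5 2 prime-5 γ-generator
mulγ²-negate 3 γ-generator = from-yes (all? λ k → mulγ (mulγ (negate k)) ≟ᶠ k)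
  where open GaloisAction 5 3 prime-5 γ-generator
mulγ²-negate 4 (_ , _ , order≠2) = ⊥-elim (order≠2 2 (s≤s z≤n) (s≤s (s≤s (s≤s z≤n))) ≡.refl)
mulγ²-negate (suc (suc (suc (suc (suc _))))) (_ , s≤s (s≤s (s≤s (s≤s (s≤s ())))) , _)

σ²≗∘negate : ∀ γ → IsGenerator 5 γ → ∀ (a : Fin 5 → ℤ) → σ 5 γ (σ 5 γ a) ≗ (λ k → a (negate k))
σ²≗∘negate γ γ-generator a k = begin
  σ 5 γ (σ 5 γ a) k                          ≡⟨ ≡.cong (σ 5 γ (σ 5 γ a)) (mulγ²-negate γ γ-generator k) ⟨
  σ 5 γ (σ 5 γ a) (mulγ (mulγ (negate k)))   ≡⟨ σ-mulγ (σ 5 γ a) (mulγ (negate k)) ⟩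
  σ 5 γ a (mulγ (negate k))                  ≡⟨ σ-mulγ a (negate k) ⟩
  a (negate k)                               ∎
  where
  open ≡.≡-Reasoning
  open GaloisAction 5 γ prime-5 γ-generator


-- Weil sums

module WeilSums {c ℓ : Level} (K : FiniteField c ℓ) {p : ℕ} (p-prime : Prime p)
                (char-p : FiniteField._≈_ K (ι K p) (FiniteField.0# K)) (n s : ℕ) where
  open FiniteField K
  open FieldProperties K
  open Characteristic K p-prime char-p
  open SumOverField K

  phase : Carrier → Carrier → Carrier
  phase u x = pow K x s - u * x

  phase-congˡ : ∀ {u u′} x → u ≈ u′ → phase u x ≈ phase u′ x
  phase-congˡ x u≈u′ = +-congˡ (-‿cong (*-congʳ u≈u′))

  phase-congʳ : ∀ u {x x′} → x ≈ x′ → phase u x ≈ phase u x′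
  phase-congʳ u x≈x′ = +-cong (pow-cong s x≈x′) (-‿cong (*-congˡ x≈x′))

  N : Carrier → ℕ → ℕ
  N u j = #fiber (λ x → Tr K p n (phase u x)) (ι K j)

  W≡N : ∀ u j → W K p n s u j ≡ + N u (toℕ j)
  W≡N u j = ≡.cong +_ (length-filter≡sum-χ (λ i → Tr K p n (phase u (enum i)) ≟ ι K (toℕ j)) (λ i → i))

  N-cong : ∀ {u u′} j → u ≈ u′ → N u j ≡ N u′ j
  N-cong j u≈u′ = #fiber-cong (λ x → Tr-cong n (phase-congˡ x u≈u′)) refl

  W-cong : ∀ {u u′} → u ≈ u′ → W K p n s u ≗ W K p n s u′
  W-cong u≈u′ j = ≡.trans (W≡N _ j) (≡.trans (≡.cong +_ (N-cong (toℕ j) u≈u′)) (≡.sym (W≡N _ j)))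

  T : ℕ → ℕ
  T j = #fiber (Tr K p n) (ι K j)

  T-translate : ∀ {v} j → Tr K p n v ≈ ι K j → T 0 ≡ T j
  T-translate {v} j Trv≈j = ≡.sym (begin
    #fiber (Tr K p n) (ι K j)
      ≡⟨ #fiber-reindex (+-↔ v) (Tr-cong n) (ι K j) ⟩
    #fiber (λ x → Tr K p n (x + v)) (ι K j)
      ≡⟨ #fiber-cong (λ x → trans (Tr-+ n x v) (+-congˡ Trv≈j)) (sym (+-identityˡ _)) ⟩
    #fiber (λ x → Tr K p n x + ι K j) (0# + ι K j)
      ≡⟨ #fiber-+ (ι K j) (Tr K p n) 0# ⟩
    T 0
      ∎)
    where open ≡.≡-Reasoning

  #fiber-phase-≉0 : ∀ {x} → ¬ x ≈ 0# → ∀ j → #fiber (λ u → Tr K p n (phase u x)) (ι K j) ≡ T j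
  #fiber-phase-≉0 {x} x≉0 j = ≡.sym (≡.trans (#fiber-reindex affine (Tr-cong n) (ι K j))
                                         (#fiber-cong (λ u → Tr-cong n (rearrange u)) refl))
    where
    affine : K↔K
    affine = *-↔ x≉0 ↔∘↔ (-‿↔ ↔∘↔ +-↔ (pow K x s))
    rearrange : ∀ u → - (x * u) + pow K x s ≈ phase u x
    rearrange u = trans (+-comm _ _) (+-congˡ (-‿cong (*-comm x u)))

module TraceCounting {c ℓ : Level} (K : FiniteField c ℓ) {p : ℕ} (p-prime : Prime p)
                     (char-p : FiniteField._≈_ K (ι K p) (FiniteField.0# K)) (n : ℕ) {s : ℕ}
                     (1≤s : 1 ≤ s) (s-coprime : gcd s (FiniteField.order K ∸ 1) ≡ 1) where
  open FiniteField K
  open FieldProperties K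
  open Characteristic K p-prime char-p
  open SumOverField K
  open Root K 1≤s s-coprime
  open WeilSums K p-prime char-p n s

  N-0# : ∀ j → N 0# j ≡ T j
  N-0# j = ≡.sym (≡.trans (#fiber-reindex pow-↔ (Tr-cong n) (ι K j))
                          (#fiber-cong (λ x → Tr-cong n (sym (phase-0# {x}))) refl))
    where
    open import Algebra.Properties.Group +-group using (ε⁻¹≈ε)
    phase-0# : ∀ {x} → phase 0# x ≈ pow K x s
    phase-0# {x} = trans (+-congˡ (trans (-‿cong (zeroˡ x)) ε⁻¹≈ε)) (+-identityʳ _)

  S : ℕ → ℕ
  S j = ∑ℕ (λ u → N u j)

  private
    open ℕΣ using (∑-comm; sum-all-but-one; _×ᴹ_)

    0ᴷ : Carrier
    0ᴷ = enum (index 0#)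

    Tr-phase-0ᴷ : ∀ u → Tr K p n (phase u 0ᴷ) ≈ 0#
    Tr-phase-0ᴷ u = trans (Tr-cong n phase≈0) (Tr-0# n)
      where
      0ᴷ≈0 = enum-index 0#
      phase≈0 : phase u 0ᴷ ≈ 0#
      phase≈0 = trans (+-cong (trans (pow-cong s 0ᴷ≈0) (pow-0# 1≤s)) (-‿cong (trans (*-congˡ 0ᴷ≈0) (zeroʳ u))))
                      (-‿inverseʳ 0#)

  S-formula : ∀ j → T j ℕ.+ S j ≡ #fiber (λ u → Tr K p n (phase u 0ᴷ)) (ι K j) ℕ.+ order ×ᴹ T j
  S-formula j = ≡.trans (≡.cong (T j ℕ.+_) (∑-comm (λ k i → χ (Tr K p n (phase (enum k) (enum i)) ≟ ι K j))))
                        (sum-all-but-one (index 0#) _ ≡.refl fiber-≉0)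
    where
    fiber-≉0 : ∀ i → ¬ i ≡ index 0# → #fiber (λ u → Tr K p n (phase u (enum i))) (ι K j) ≡ T j
    fiber-≉0 i i≢0 = #fiber-phase-≉0 (λ eᵢ≈0 → i≢0 (enum≈0⇒≡index0 eᵢ≈0)) j

  S-0≡q+S : ∀ j → ¬ ι K j ≈ 0# → T 0 ≡ T j → S 0 ≡ order ℕ.+ S j
  S-0≡q+S j ιj≉0 T0≡Tj = ℕ.+-cancelˡ-≡ (T 0) _ _ (begin
    T 0 ℕ.+ S 0                         ≡⟨ S-formula 0 ⟩
    _ ℕ.+ order ×ᴹ T 0                  ≡⟨ ≡.cong₂ ℕ._+_ (#fiber-all Tr-phase-0ᴷ) (≡.cong (order ×ᴹ_) T0≡Tj) ⟩
    order ℕ.+ order ×ᴹ T j              ≡⟨ ≡.cong (order ℕ.+_) Tj+Sj≡q×Tj ⟨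
    order ℕ.+ (T j ℕ.+ S j)            ≡⟨ ≡.cong (λ t → order ℕ.+ (t ℕ.+ S j)) (≡.sym T0≡Tj) ⟩
    order ℕ.+ (T 0 ℕ.+ S j)            ≡⟨ x∙yz≈y∙xz order (T 0) (S j) ⟩
    T 0 ℕ.+ (order ℕ.+ S j)            ∎)
    where
    open ≡.≡-Reasoning
    open import Algebra.Properties.CommutativeSemigroup ℕ.+-commutativeSemigroup using (x∙yz≈y∙xz)
    Tj+Sj≡q×Tj : T j ℕ.+ S j ≡ order ×ᴹ T j
    Tj+Sj≡q×Tj = ≡.trans (S-formula j) (≡.cong (ℕ._+ order ×ᴹ T j)
                   (#fiber-none (λ u Tr≈ιj → ιj≉0 (trans (sym Tr≈ιj) (Tr-phase-0ᴷ u)))))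

module GaloisOnWeilSums {c ℓ : Level} (K : FiniteField c ℓ) (p n s γ : ℕ) .{{_ : NonZero p}}
                        (p-prime : Prime p) (char-p : FiniteField._≈_ K (ι K p) (FiniteField.0# K))
                        (1≤s : 1 ≤ s) (s-coprime : gcd s (FiniteField.order K ∸ 1) ≡ 1)
                        (γ-generator : IsGenerator p γ) where
  open FiniteField K
  open FieldProperties K
  open Characteristic K p-prime char-p
  open SumOverField K
  open Root K 1≤s s-coprime
  open Cyclotomic p
  open GaloisAction p γ p-prime γ-generator
  open WeilSums K p-prime char-p n s

  γᴷ : Carrier
  γᴷ = ι K γ

  γᴷ≉0 : ¬ γᴷ ≈ 0#
  γᴷ≉0 = ι-≉0 (proj₁ γ-generator) (proj₁ (proj₂ γ-generator))

  γ^[1/s] : Carrier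
  γ^[1/s] = root γᴷ

  γ^[1/s]≉0 : ¬ γ^[1/s] ≈ 0#
  γ^[1/s]≉0 root≈0 = γᴷ≉0 (trans (sym (pow-root γᴷ)) (trans (pow-cong s root≈0) (pow-0# 1≤s)))

  γ^[-1/s] : Carrier
  γ^[-1/s] = proj₁ (inverse γ^[1/s] γ^[1/s]≉0)

  γ^[1-1/s] : Carrier
  γ^[1-1/s] = γᴷ * γ^[-1/s]

  γ^[1/s]*γ^[-1/s]≈1 : γ^[1/s] * γ^[-1/s] ≈ 1#
  γ^[1/s]*γ^[-1/s]≈1 = proj₂ (inverse γ^[1/s] γ^[1/s]≉0)

  γ^[1-1/s]≉0 : ¬ γ^[1-1/s] ≈ 0#
  γ^[1-1/s]≉0 = *-≉0 γᴷ≉0 (λ inv≈0 → 1≉0 (trans (sym γ^[1/s]*γ^[-1/s]≈1) (trans (*-congˡ inv≈0) (zeroʳ _))))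

  ι-mulγ : ∀ j → ι K (toℕ (mulγ j)) ≈ γᴷ * ι K (toℕ j)
  ι-mulγ j = trans (reflexive (≡.cong (ι K) (toℕ-mulγ j))) (trans (ι-% (γ ℕ.* toℕ j)) (ι-* γ (toℕ j)))

  phase-scale : ∀ u x → phase (γ^[1-1/s] * u) (γ^[1/s] * x) ≈ γᴷ * phase u x
  phase-scale u x = begin
    pow K (γ^[1/s] * x) s - (γ^[1-1/s] * u) * (γ^[1/s] * x)  ≈⟨ +-cong power (-‿cong linear) ⟩
    γᴷ * pow K x s - γᴷ * (u * x)                            ≈⟨ x[y-z]≈xy-xz γᴷ _ _ ⟨
    γᴷ * (pow K x s - u * x)                                 ∎
    where
    open import Relation.Binary.Reasoning.Setoid setoid
    open import Algebra.Properties.Ring ring using (x[y-z]≈xy-xz)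
    open import Algebra.Solver.CommutativeMonoid *-commutativeMonoid using (_⊕_; _⊜_; solve)
    power : pow K (γ^[1/s] * x) s ≈ γᴷ * pow K x s
    power = trans (pow-distrib-* γ^[1/s] x s) (*-congʳ (pow-root γᴷ))
    linear : (γ^[1-1/s] * u) * (γ^[1/s] * x) ≈ γᴷ * (u * x)
    linear = begin
      ((γᴷ * γ^[-1/s]) * u) * (γ^[1/s] * x)
        ≈⟨ solve 5 (λ g i u r x → ((g ⊕ i) ⊕ u) ⊕ (r ⊕ x) ⊜ (g ⊕ (u ⊕ x)) ⊕ (r ⊕ i)) refl γᴷ γ^[-1/s] u γ^[1/s] x ⟩
      (γᴷ * (u * x)) * (γ^[1/s] * γ^[-1/s])  ≈⟨ *-congˡ γ^[1/s]*γ^[-1/s]≈1 ⟩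
      (γᴷ * (u * x)) * 1#                    ≈⟨ *-identityʳ _ ⟩
      γᴷ * (u * x)                           ∎

  N-mulγ : ∀ u j → N (γ^[1-1/s] * u) (toℕ (mulγ j)) ≡ N u (toℕ j)
  N-mulγ u j = begin
    N (γ^[1-1/s] * u) (toℕ (mulγ j))
      ≡⟨ #fiber-reindex (*-↔ γ^[1/s]≉0) (λ x≈x′ → Tr-cong n (phase-congʳ _ x≈x′)) _ ⟩
    #fiber (λ x → Tr K p n (phase (γ^[1-1/s] * u) (γ^[1/s] * x))) (ι K (toℕ (mulγ j)))
      ≡⟨ #fiber-cong (λ x → trans (Tr-cong n (phase-scale u x)) (Tr-*-fixed n (ι-fermat γ) _)) (ι-mulγ j) ⟩
    #fiber (λ x → γᴷ * Tr K p n (phase u x)) (γᴷ * ι K (toℕ j))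
      ≡⟨ #fiber-* γᴷ≉0 (λ x → Tr K p n (phase u x)) _ ⟩
    N u (toℕ j) ∎
    where open ≡.≡-Reasoning

  σ-W : ∀ u → σ p γ (W K p n s u) ≗ W K p n s (γ^[1-1/s] * u)
  σ-W u = σ-≗ λ j → ≡.trans (W≡N _ (mulγ j)) (≡.trans (≡.cong +_ (N-mulγ u j)) (≡.sym (W≡N u j)))

module Characteristic5 {c ℓ : Level} (K : FiniteField c ℓ)
                       (char-5 : FiniteField._≈_ K (ι K 5) (FiniteField.0# K)) where
  open FiniteField K
  open FieldProperties K
  open SumOverField K
  open Characteristic K prime-5 char-5
  open import Algebra.Properties.Ring ring using (-‿distribʳ-*)
  open import Algebra.Properties.Group +-group using (inverseʳ-unique)
  open import Algebra.Properties.AbelianGroup +-abelianGroup using (⁻¹-∙-comm)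
  open import Relation.Binary.Reasoning.Setoid setoid

  ι-negate : ∀ k → ι K (toℕ (negate k)) ≈ - ι K (toℕ k)
  ι-negate k = inverseʳ-unique _ _ (sum≈0 k)
    where
    sum≈0 : ∀ k → ι K (toℕ k) + ι K (toℕ (negate k)) ≈ 0#
    sum≈0 0F = +-identityˡ 0#
    sum≈0 1F = trans (sym (ι-+ 1 4)) char-5
    sum≈0 2F = trans (sym (ι-+ 2 3)) char-5
    sum≈0 3F = trans (sym (ι-+ 3 2)) char-5
    sum≈0 4F = trans (sym (ι-+ 4 1)) char-5

  module _ (n : ℕ) {s : ℕ} (2∤s : ¬ 2 ∣ s) where
    open WeilSums K prime-5 char-5 n s

    phase-neg : ∀ u x → phase u (- x) ≈ - phase u x
    phase-neg u x = begin
      pow K (- x) s - u * (- x)     ≈⟨ +-cong (pow-neg-odd 2∤s x) (-‿cong (sym (-‿distribʳ-* u x))) ⟩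
      - pow K x s - - (u * x)       ≈⟨ ⁻¹-∙-comm _ _ ⟩
      - (pow K x s - u * x)         ∎

    N-negate : ∀ u k → N u (toℕ (negate k)) ≡ N u (toℕ k)
    N-negate u k = ≡.trans (#fiber-reindex -‿↔ (Tr-cong n ∘ phase-congʳ u) (ι K (toℕ (negate k))))
                     (≡.trans (#fiber-cong (λ x → trans (Tr-cong n (phase-neg u x)) (Tr-neg n _)) (ι-negate k))
                              (#fiber-neg (λ x → Tr K 5 n (phase u x)) (ι K (toℕ k))))

    W-negate : ∀ u k → W K 5 n s u (negate k) ≡ W K 5 n s u k
    W-negate u k = ≡.trans (W≡N u (negate k)) (≡.trans (≡.cong +_ (N-negate u k)) (≡.sym (W≡N u k)))


-- A four-cycle of σ

module FourCycle {c ℓ : Level} (K : FiniteField c ℓ) (p n s γ : ℕ) .{{_ : NonZero p}}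
                 (p-prime : Prime p) (char-p : FiniteField._≈_ K (ι K p) (FiniteField.0# K))
                 (1≤s : 1 ≤ s) (s-coprime : gcd s (FiniteField.order K ∸ 1) ≡ 1)
                 (γ-generator : IsGenerator p γ)
                 (w : Fin 4 → FiniteField.Carrier K)
                 (w-cover : ∀ u → ¬ FiniteField._≈_ K u (FiniteField.0# K)
                              → ∃ λ i → ZζEq (W K p n s u) (W K p n s (w i)))
                 (u₀ : FiniteField.Carrier K) (u₀≉0 : ¬ FiniteField._≈_ K u₀ (FiniteField.0# K))
                 (cycle : ∀ (i j : Fin 4) → ZζEq (σ^ p γ (toℕ i) (W K p n s u₀)) (σ^ p γ (toℕ j) (W K p n s u₀))
                            → i ≡ j)
                 where
  open FiniteField K
  open FieldProperties K
  open Characteristic K p-prime char-p using (ι-≉0)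
  open SumOverField K
  open Cyclotomic p
  open GaloisAction p γ p-prime γ-generator
  open WeilSums K p-prime char-p n s
  open TraceCounting K p-prime char-p n 1≤s s-coprime
  open GaloisOnWeilSums K p n s γ p-prime char-p 1≤s s-coprime γ-generator
  open import Algebra.Properties.Semiring.Sum ℤ.+-*-semiring using (*-distribˡ-sum; *-distribʳ-sum)

  weil : Carrier → Fin p → ℤ
  weil = W K p n s

  orbit : ℕ → Carrier
  orbit i = pow K γ^[1-1/s] i * u₀

  orbit-≉0 : ∀ i → ¬ orbit i ≈ 0#
  orbit-≉0 i = *-≉0 (pow-≉0 i γ^[1-1/s]≉0) u₀≉0

  σ-weil-orbit : ∀ i → σ p γ (weil (orbit i)) ≗ weil (orbit (suc i))
  σ-weil-orbit i k =
    ≡.trans (σ-W (orbit i) k) (W-cong {γ^[1-1/s] * orbit i} {orbit (suc i)} (sym (*-assoc _ _ u₀)) k)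

  σ^-weil : ∀ i → σ^ p γ i (weil u₀) ≗ weil (orbit i)
  σ^-weil zero    = W-cong {u₀} {orbit 0} (sym (*-identityˡ u₀))
  σ^-weil (suc i) k = ≡.trans (σ-cong (σ^-weil i) k) (σ-weil-orbit i k)

  class : Fin 4 → Fin p → ℤ
  class i = weil (orbit (toℕ i))

  class-injective : ∀ i j → ZζEq (class i) (class j) → i ≡ j
  class-injective i j classᵢ≈classⱼ = cycle i j (begin
    σ^ p γ (toℕ i) (weil u₀)  ≈⟨ ≗⇒ZζEq (σ^-weil (toℕ i)) ⟩
    class i                   ≈⟨ classᵢ≈classⱼ ⟩
    class j                   ≈⟨ ≗⇒ZζEq (σ^-weil (toℕ j)) ⟨
    σ^ p γ (toℕ j) (weil u₀)  ∎)
    where open import Relation.Binary.Reasoning.Setoid ℤ[ζ]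

  private
    κ : Fin 4 → Fin 4
    κ i = proj₁ (w-cover (orbit (toℕ i)) (orbit-≉0 (toℕ i)))

    κ-spec : ∀ i → ZζEq (class i) (weil (w (κ i)))
    κ-spec i = proj₂ (w-cover (orbit (toℕ i)) (orbit-≉0 (toℕ i)))

    κ-injective : ∀ i j → κ i ≡ κ j → i ≡ j
    κ-injective i j κi≡κj = class-injective i j (begin
      class i          ≈⟨ κ-spec i ⟩
      weil (w (κ i))   ≡⟨ ≡.cong (λ k → weil (w k)) κi≡κj ⟩
      weil (w (κ j))   ≈⟨ κ-spec j ⟨
      class j          ∎)
      where open import Relation.Binary.Reasoning.Setoid ℤ[ζ]

  -- The four classes of the orbit are distinct, so they exhaust the four values of W.
  class-cover : ∀ u → ¬ u ≈ 0# → ∃ λ i → ZζEq (weil u) (class i)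
  class-cover u u≉0 = i , (begin
    weil u           ≈⟨ proj₂ (w-cover u u≉0) ⟩
    weil (w k)       ≡⟨ ≡.cong (λ k → weil (w k)) κi≡k ⟨
    weil (w (κ i))   ≈⟨ κ-spec i ⟨
    class i          ∎)
    where
    open import Relation.Binary.Reasoning.Setoid ℤ[ζ]
    k = proj₁ (w-cover u u≉0)
    i = proj₁ (injective⇒surjective κ κ-injective k)
    κi≡k = proj₂ (injective⇒surjective κ κ-injective k)

  InClass : Fin 4 → Carrier → Set ℓ
  InClass i u = ¬ u ≈ 0# × ZζEq (weil u) (class i)

  InClass? : ∀ i u → Dec (InClass i u)
  InClass? i u = ¬? (u ≟ 0#) ×-dec ZζEq? (weil u) (class i)

  InClass-unique : ∀ {i j u} → InClass i u → InClass j u → i ≡ j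
  InClass-unique {i} {j} {u} (_ , weilᵤ≈classᵢ) (_ , weilᵤ≈classⱼ) =
    class-injective i j (begin
      class i  ≈⟨ weilᵤ≈classᵢ ⟨
      weil u   ≈⟨ weilᵤ≈classⱼ ⟩
      class j  ∎)
    where open import Relation.Binary.Reasoning.Setoid ℤ[ζ]

  InClass-cong : ∀ {i u u′} → u ≈ u′ → InClass i u → InClass i u′
  InClass-cong {i} {u} {u′} u≈u′ (u≉0 , weilᵤ≈classᵢ) = (λ u′≈0 → u≉0 (trans u≈u′ u′≈0)) , (begin
    weil u′   ≈⟨ ≗⇒ZζEq (W-cong {u′} {u} (sym u≈u′)) ⟩
    weil u    ≈⟨ weilᵤ≈classᵢ ⟩
    class i   ∎)
    where open import Relation.Binary.Reasoning.Setoid ℤ[ζ]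

  classSize : Fin 4 → ℕ
  classSize i = ∑ℕ (λ u → χ (InClass? i u))

  module _ {i i′ : Fin 4} (i′≡1+i : toℕ i′ ≡ suc (toℕ i)) where
    private
      σ-class : class i′ ≗ σ p γ (class i)
      σ-class k = ≡.trans (≡.cong (λ m → weil (orbit m) k) i′≡1+i) (≡.sym (σ-weil-orbit (toℕ i) k))

      σ-weil : ∀ u → ZζEq (σ p γ (weil u)) (weil (γ^[1-1/s] * u))
      σ-weil u = ≗⇒ZζEq (σ-W u)

    InClass-shift⁻¹ : ∀ {u} → InClass i′ (γ^[1-1/s] * u) → InClass i u
    InClass-shift⁻¹ {u} (cu≉0 , weil-cu≈class) =
      (λ u≈0 → cu≉0 (trans (*-congˡ u≈0) (zeroʳ _))) , σ-ZζEq⁻¹ {weil u} {class i} (begin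
        σ p γ (weil u)             ≈⟨ σ-weil u ⟩
        weil (γ^[1-1/s] * u)       ≈⟨ weil-cu≈class ⟩
        class i′                   ≈⟨ ≗⇒ZζEq σ-class ⟩
        σ p γ (class i)            ∎)
      where open import Relation.Binary.Reasoning.Setoid ℤ[ζ]

    InClass-shift : ∀ {u} → InClass i u → InClass i′ (γ^[1-1/s] * u)
    InClass-shift {u} (u≉0 , weilᵤ≈class) = *-≉0 γ^[1-1/s]≉0 u≉0 , (begin
      weil (γ^[1-1/s] * u)       ≈⟨ σ-weil u ⟨
      σ p γ (weil u)             ≈⟨ σ-ZζEq {weil u} {class i} weilᵤ≈class ⟩
      σ p γ (class i)            ≈⟨ ≗⇒ZζEq σ-class ⟨
      class i′                   ∎)
      where open import Relation.Binary.Reasoning.Setoid ℤ[ζ]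

    classSize-shift : classSize i′ ≡ classSize i
    classSize-shift = ≡.trans (∑K-reindex ℕ.+-0-commutativeMonoid (*-↔ γ^[1-1/s]≉0) _ χ-InClass-cong)
                        (ℕΣ.sum-cong-≋
                          (λ k → χ-cong InClass-shift⁻¹ InClass-shift
                                          (InClass? i′ (γ^[1-1/s] * enum k)) (InClass? i (enum k))))
      where
      χ-InClass-cong : ∀ {u u′} → u ≈ u′ → χ (InClass? i′ u) ≡ χ (InClass? i′ u′)
      χ-InClass-cong {u} {u′} u≈u′ =
        χ-cong (InClass-cong {i′} u≈u′) (InClass-cong {i′} (sym u≈u′)) (InClass? i′ u) (InClass? i′ u′)

  private
    size₁≡size₀ : classSize (fsuc fzero) ≡ classSize fzero
    size₁≡size₀ = classSize-shift {fzero} {fsuc fzero} ≡.refl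

    size₂≡size₁ : classSize (fsuc (fsuc fzero)) ≡ classSize (fsuc fzero)
    size₂≡size₁ = classSize-shift {fsuc fzero} {fsuc (fsuc fzero)} ≡.refl

    size₃≡size₂ : classSize (fsuc (fsuc (fsuc fzero))) ≡ classSize (fsuc (fsuc fzero))
    size₃≡size₂ = classSize-shift {fsuc (fsuc fzero)} {fsuc (fsuc (fsuc fzero))} ≡.refl

  classSize-constant : ∀ i → classSize i ≡ classSize fzero
  classSize-constant fzero                      = ≡.refl
  classSize-constant (fsuc fzero)               = size₁≡size₀
  classSize-constant (fsuc (fsuc fzero))        = ≡.trans size₂≡size₁ size₁≡size₀
  classSize-constant (fsuc (fsuc (fsuc fzero))) = ≡.trans size₃≡size₂ (≡.trans size₂≡size₁ size₁≡size₀)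

  module Partition (Φ : Carrier → ℤ) (φ : Fin 4 → ℤ) (Φ≡φ : ∀ i u → InClass i u → Φ u ≡ φ i) where
    private
      χℤ : ∀ {a} {A : Set a} → Dec A → ℤ
      χℤ A? = + χ A?

      χℤ-yes-* : ∀ {a} {A : Set a} (A? : Dec A) → A → ∀ x → χℤ A? ℤ.* x ≡ x
      χℤ-yes-* A? a x = ≡.trans (≡.cong (λ t → + t ℤ.* x) (χ-yes A? a)) (ℤ.*-identityˡ x)

      χℤ-no-* : ∀ {a} {A : Set a} (A? : Dec A) → ¬ A → ∀ x → χℤ A? ℤ.* x ≡ + 0
      χℤ-no-* A? ¬a x = ≡.cong (λ t → + t ℤ.* x) (χ-no A? ¬a)

      classValue : Carrier → ℤ
      classValue u = ℤΣ.sum (λ i → χℤ (InClass? i u) ℤ.* φ i)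

      classValue-0 : ∀ {u} → u ≈ 0# → classValue u ≡ + 0
      classValue-0 {u} u≈0 = ≡.trans (ℤΣ.sum-cong-≋ (λ i → χℤ-no-* (InClass? i u) (λ (u≉0 , _) → u≉0 u≈0) (φ i)))
                                     (ℤΣ.sum-replicate-zero 4)

      Φ≡classValue : ∀ {u} → ¬ u ≈ 0# → Φ u ≡ classValue u
      Φ≡classValue {u} u≉0 = begin
        Φ u                          ≡⟨ Φ≡φ i₀ u in-i₀ ⟩
        φ i₀                         ≡⟨ χℤ-yes-* (InClass? i₀ u) in-i₀ (φ i₀) ⟨
        χℤ (InClass? i₀ u) ℤ.* φ i₀  ≡⟨ ℤΣ.sum-single i₀ (λ i → χℤ (InClass? i u) ℤ.* φ i) other-classes ⟨
        classValue u                 ∎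
        where
        open ≡.≡-Reasoning
        i₀ = proj₁ (class-cover u u≉0)
        in-i₀ : InClass i₀ u
        in-i₀ = u≉0 , proj₂ (class-cover u u≉0)
        other-classes : ∀ i → ¬ i ≡ i₀ → χℤ (InClass? i u) ℤ.* φ i ≡ + 0
        other-classes i i≢i₀ = χℤ-no-* (InClass? i u) (λ inᵢ → i≢i₀ (InClass-unique {i} {i₀} {u} inᵢ in-i₀)) (φ i)

      split : ∀ u (u≟0 : Dec (u ≈ 0#)) → Φ u ≡ χℤ u≟0 ℤ.* Φ u ℤ.+ classValue u
      split u (yes u≈0) =
        ≡.sym (≡.trans (≡.cong₂ ℤ._+_ (ℤ.*-identityˡ (Φ u)) (classValue-0 u≈0)) (ℤ.+-identityʳ (Φ u)))
      split u (no u≉0)  = ≡.trans (Φ≡classValue u≉0) (≡.sym (ℤ.+-identityˡ (classValue u)))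

      zero-term : ℤΣ.sum (λ k → χℤ (enum k ≟ 0#) ℤ.* Φ (enum k)) ≡ Φ (enum (index 0#))
      zero-term = ≡.trans (ℤΣ.sum-single (index 0#) _ not-0) (χℤ-yes-* (enum (index 0#) ≟ 0#) (enum-index 0#) _)
        where
        not-0 : ∀ k → ¬ k ≡ index 0# → χℤ (enum k ≟ 0#) ℤ.* Φ (enum k) ≡ + 0
        not-0 k k≢0 = χℤ-no-* (enum k ≟ 0#) (λ eₖ≈0 → k≢0 (enum≈0⇒≡index0 eₖ≈0)) _

      class-terms : ℤΣ.sum (λ k → classValue (enum k)) ≡ ℤΣ.sum (λ i → + classSize i ℤ.* φ i)
      class-terms = ≡.trans (ℤΣ.∑-comm (λ k i → χℤ (InClass? i (enum k)) ℤ.* φ i)) (ℤΣ.sum-cong-≋ λ i →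
        ≡.trans (≡.sym (*-distribʳ-sum (φ i) (λ k → χℤ (InClass? i (enum k)))))
                (≡.cong (ℤ._* φ i) (sum-pos (λ k → χ (InClass? i (enum k))))))

    ∑ℤ-partition : ∑ℤ Φ ≡ Φ (enum (index 0#)) ℤ.+ ℤΣ.sum (λ i → + classSize i ℤ.* φ i)
    ∑ℤ-partition = begin
      ∑ℤ Φ
        ≡⟨ ℤΣ.sum-cong-≋ (λ k → split (enum k) (enum k ≟ 0#)) ⟩
      ℤΣ.sum (λ k → χℤ (enum k ≟ 0#) ℤ.* Φ (enum k) ℤ.+ classValue (enum k))
        ≡⟨ ℤΣ.∑-distrib-+ (λ k → χℤ (enum k ≟ 0#) ℤ.* Φ (enum k)) (λ k → classValue (enum k)) ⟩
      ℤΣ.sum (λ k → χℤ (enum k ≟ 0#) ℤ.* Φ (enum k)) ℤ.+ ℤΣ.sum (λ k → classValue (enum k))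
        ≡⟨ ≡.cong₂ ℤ._+_ zero-term class-terms ⟩
      Φ (enum (index 0#)) ℤ.+ ℤΣ.sum (λ i → + classSize i ℤ.* φ i)
        ∎
      where open ≡.≡-Reasoning

  m : ℕ
  m = classSize fzero

  private
    ∑-classes : ∀ (φ : Fin 4 → ℤ) → ℤΣ.sum (λ i → + classSize i ℤ.* φ i) ≡ + m ℤ.* ℤΣ.sum φ
    ∑-classes φ = ≡.trans (ℤΣ.sum-cong-≋ (λ i → ≡.cong (λ t → + t ℤ.* φ i) (classSize-constant i)))
                          (≡.sym (*-distribˡ-sum (+ m) φ))

  order≡1+m*4 : order ≡ 1 ℕ.+ m ℕ.* 4
  order≡1+m*4 = ℤ.+-injective (begin
    + order                                         ≡⟨ ≡.cong +_ (sum-ones order) ⟨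
    + ℕΣ.sum (λ (_ : Fin order) → 1)                ≡⟨ sum-pos {order} (λ _ → 1) ⟨
    ∑ℤ (λ _ → + 1)                                  ≡⟨ ∑ℤ-partition ⟩
    + 1 ℤ.+ ℤΣ.sum (λ i → + classSize i ℤ.* + 1)    ≡⟨ ≡.cong (λ z → + 1 ℤ.+ z) (∑-classes (λ _ → + 1)) ⟩
    + 1 ℤ.+ + m ℤ.* + 4                             ≡⟨ ≡.cong (λ z → + 1 ℤ.+ z) (ℤ.pos-* m 4) ⟨
    + (1 ℕ.+ m ℕ.* 4)                               ∎)
    where
    open ≡.≡-Reasoning
    open Partition (λ _ → + 1) (λ _ → + 1) (λ _ _ _ → ≡.refl)

  private
    VanishingCoefficient : Fin p → Set
    VanishingCoefficient j = ¬ j ≡ 0ᶠ → N u₀ (toℕ j) ≡ 0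

    ¬all-vanishing : ¬ (∀ j → VanishingCoefficient j)
    ¬all-vanishing vanishing = 1≢0 (cycle (fsuc fzero) fzero σ-fixes-weil₀)
      where
      1≢0 : ¬ fsuc fzero ≡ fzero
      1≢0 ()
      weil₀≡0 : ∀ j → ¬ j ≡ 0ᶠ → weil u₀ j ≡ + 0
      weil₀≡0 j j≢0 = ≡.trans (W≡N u₀ j) (≡.cong +_ (vanishing j j≢0))
      σ-fixes-weil₀ : ZζEq (σ p γ (weil u₀)) (weil u₀)
      σ-fixes-weil₀ = ≗⇒ZζEq {σ p γ (weil u₀)} {weil u₀} (σ-fixes-0-supported {weil u₀} weil₀≡0)

    -- Since W_{u₀} is not σ-invariant, it is not an integer, so Tr(x^s - u₀x) takes some value j ≠ 0.
    nonvanishing : ∃ λ j → ¬ VanishingCoefficient j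
    nonvanishing = ¬∀⟶∃¬ p VanishingCoefficient (λ j → ¬? (j ≟ᶠ 0ᶠ) →-dec (N u₀ (toℕ j) ℕ.≟ 0)) ¬all-vanishing

  j₁ : Fin p
  j₁ = proj₁ nonvanishing

  j₁≢0 : ¬ j₁ ≡ 0ᶠ
  j₁≢0 j₁≡0 = proj₂ nonvanishing (λ j₁≢0 → ⊥-elim (j₁≢0 j₁≡0))

  ι-j₁≉0 : ¬ ι K (toℕ j₁) ≈ 0#
  ι-j₁≉0 = ι-≉0 1≤j₁ (toℕ<n j₁)
    where
    1≤j₁ : 1 ≤ toℕ j₁
    1≤j₁ with toℕ j₁ in eq
    ... | zero  = ⊥-elim (j₁≢0 (toℕ-injective (≡.trans eq (≡.sym toℕ-0ᶠ))))
    ... | suc _ = s≤s z≤n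

  T-0≡T-j₁ : T 0 ≡ T (toℕ j₁)
  T-0≡T-j₁ = T-translate (toℕ j₁) (proj₂ value-j₁)
    where
    value-j₁ : ∃ λ x → Tr K p n (phase u₀ x) ≈ ι K (toℕ j₁)
    value-j₁ = #fiber≢0⇒∃ {λ x → Tr K p n (phase u₀ x)} {ι K (toℕ j₁)} (λ N≡0 → proj₂ nonvanishing (λ _ → N≡0))

  private
    open import Data.Integer.Solver using (module +-*-Solver)
    open +-*-Solver

    -- Φ u is the difference of the coefficients of ζ⁰ and ζ^j₁ in W_u, which is invariant under ZζEq.
    Φ : Carrier → ℤ
    Φ u = + N u 0 ℤ.- + N u (toℕ j₁)

    φ : Fin 4 → ℤ
    φ i = class i 0ᶠ ℤ.- class i j₁

    Φ≡φ : ∀ i u → InClass i u → Φ u ≡ φ i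
    Φ≡φ i u (_ , c , weil≡class+c) = begin
      + N u 0 ℤ.- + N u (toℕ j₁)
        ≡⟨ ≡.cong₂ ℤ._-_ (≡.trans (≡.cong (λ t → + N u t) (≡.sym toℕ-0ᶠ)) (≡.sym (W≡N u 0ᶠ))) (≡.sym (W≡N u j₁)) ⟩
      weil u 0ᶠ ℤ.- weil u j₁
        ≡⟨ ≡.cong₂ ℤ._-_ (weil≡class+c 0ᶠ) (weil≡class+c j₁) ⟩
      (class i 0ᶠ ℤ.+ c) ℤ.- (class i j₁ ℤ.+ c)
        ≡⟨ solve 3 (λ a b c → (a :+ c) :- (b :+ c) := a :- b) ≡.refl (class i 0ᶠ) (class i j₁) c ⟩
      class i 0ᶠ ℤ.- class i j₁
        ∎
      where open ≡.≡-Reasoning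

    S-0≡q+S-j₁ : S 0 ≡ order ℕ.+ S (toℕ j₁)
    S-0≡q+S-j₁ = S-0≡q+S (toℕ j₁) ι-j₁≉0 T-0≡T-j₁

    ∑ℤΦ≡order : ∑ℤ Φ ≡ + order
    ∑ℤΦ≡order = begin
      ∑ℤ Φ                              ≡⟨ sum-pos-sub (λ k → N (enum k) 0) (λ k → N (enum k) (toℕ j₁)) ⟩
      + S 0 ℤ.- + S j                   ≡⟨ ≡.cong (λ t → + t ℤ.- + S j) S-0≡q+S-j₁ ⟩
      + (order ℕ.+ S j) ℤ.- + S j       ≡⟨ solve 2 (λ a b → (a :+ b) :- b := a) ≡.refl (+ order) (+ S j) ⟩
      + order                           ∎
      where
      open ≡.≡-Reasoning
      j = toℕ j₁

    Φ-0 : Φ (enum (index 0#)) ≡ + 0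
    Φ-0 = begin
      + N e₀ 0 ℤ.- + N e₀ (toℕ j₁)      ≡⟨ ≡.cong₂ (λ a b → + a ℤ.- + b) (N-at-0 0) N-at-0-j₁ ⟩
      + T 0 ℤ.- + T 0                   ≡⟨ ℤ.+-inverseʳ (+ T 0) ⟩
      + 0                               ∎
      where
      open ≡.≡-Reasoning
      e₀ = enum (index 0#)
      N-at-0 : ∀ j → N e₀ j ≡ T j
      N-at-0 j = ≡.trans (N-cong {e₀} {0#} j (enum-index 0#)) (N-0# j)
      N-at-0-j₁ : N e₀ (toℕ j₁) ≡ T 0
      N-at-0-j₁ = ≡.trans (N-at-0 (toℕ j₁)) (≡.sym T-0≡T-j₁)

  order≡m*∑φ : + order ≡ + m ℤ.* ℤΣ.sum φ
  order≡m*∑φ = begin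
    + order                                                        ≡⟨ ∑ℤΦ≡order ⟨
    ∑ℤ Φ                                                           ≡⟨ ∑ℤ-partition ⟩
    Φ (enum (index 0#)) ℤ.+ ℤΣ.sum (λ i → + classSize i ℤ.* φ i)  ≡⟨ ≡.cong₂ ℤ._+_ Φ-0 (∑-classes φ) ⟩
    + 0 ℤ.+ + m ℤ.* ℤΣ.sum φ                                       ≡⟨ ℤ.+-identityˡ _ ⟩
    + m ℤ.* ℤΣ.sum φ                                               ∎
    where
    open ≡.≡-Reasoning
    open Partition Φ φ Φ≡φ

  m≡1 : m ≡ 1
  m≡1 = ℕ.m*n≡1⇒m≡1 m _ (≡.trans (≡.sym (ℤ.abs-* (+ m) (ℤΣ.sum φ ℤ.- + 4))) (≡.cong ℤ.∣_∣ m*[∑φ-4]≡1))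
    where
    open ≡.≡-Reasoning
    m*[∑φ-4]≡1 : + m ℤ.* (ℤΣ.sum φ ℤ.- + 4) ≡ + 1
    m*[∑φ-4]≡1 = begin
      + m ℤ.* (ℤΣ.sum φ ℤ.- + 4)
        ≡⟨ solve 2 (λ m B → m :* (B :- con (+ 4)) := m :* B :- m :* con (+ 4)) ≡.refl (+ m) (ℤΣ.sum φ) ⟩
      + m ℤ.* ℤΣ.sum φ ℤ.- + m ℤ.* + 4
        ≡⟨ ≡.cong₂ ℤ._-_ (≡.sym order≡m*∑φ) (≡.sym (ℤ.pos-* m 4)) ⟩
      + order ℤ.- + (m ℕ.* 4)
        ≡⟨ ≡.cong (λ t → + t ℤ.- + (m ℕ.* 4)) order≡1+m*4 ⟩
      + 1 ℤ.+ + (m ℕ.* 4) ℤ.- + (m ℕ.* 4)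
        ≡⟨ solve 1 (λ x → (con (+ 1) :+ x) :- x := con (+ 1)) ≡.refl (+ (m ℕ.* 4)) ⟩
      + 1
        ∎

  order≡5 : order ≡ 5
  order≡5 = ≡.trans order≡1+m*4 (≡.cong (λ t → 1 ℕ.+ t ℕ.* 4) m≡1)

no-4-cycle-in-characteristic-5 :
  ∀ {c ℓ : Level} (K : FiniteField c ℓ) (p n s γ : ℕ) .{{_ : NonZero p}} → p ≡ 5 →
  FiniteField._≈_ K (ι K p) (FiniteField.0# K) → IsGenerator p γ → ¬ 2 ∣ s → ∀ u₀ →
  ¬ (∀ (i j : Fin 4) → ZζEq (σ^ p γ (toℕ i) (W K p n s u₀)) (σ^ p γ (toℕ j) (W K p n s u₀)) → i ≡ j)
no-4-cycle-in-characteristic-5 K .5 n s γ ≡.refl char-5 γ-generator 2∤s u₀ cycle = 2≢0 (cycle 2F 0F σ²W≈W)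
  where
  open Cyclotomic 5 using (≗⇒ZζEq)
  open Characteristic5 K char-5 using (W-negate)
  2≢0 : ¬ 2F ≡ 0F
  2≢0 ()
  σ²W≈W : ZζEq (σ 5 γ (σ 5 γ (W K 5 n s u₀))) (W K 5 n s u₀)
  σ²W≈W = ≗⇒ZζEq {σ 5 γ (σ 5 γ (W K 5 n s u₀))} {W K 5 n s u₀}
            (λ k → ≡.trans (σ²≗∘negate γ γ-generator (W K 5 n s u₀) k) (W-negate n 2∤s u₀ k))

proposition6p2 : ∀ {c ℓ : Level} (K : FiniteField c ℓ) (p n s γ : ℕ) .{{_ : NonZero p}}
    → Prime p
    → FiniteField._≈_ K (ι K p) (FiniteField.0# K)
    → FiniteField.order K ≡ p ^ n
    → 1 ≤ s
    → gcd s (FiniteField.order K ∸ 1) ≡ 1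
    → IsGenerator p γ
    → (∃ λ (w : Fin 4 → FiniteField.Carrier K)
         → (∀ i → ¬ FiniteField._≈_ K (w i) (FiniteField.0# K))
         × (∀ i j → ZζEq (W K p n s (w i)) (W K p n s (w j)) → i ≡ j)
         × (∀ u → ¬ FiniteField._≈_ K u (FiniteField.0# K)
              → ∃ λ i → ZζEq (W K p n s u) (W K p n s (w i))))
    → ¬ (∃ λ u → ¬ FiniteField._≈_ K u (FiniteField.0# K)
           × (∀ (i j : Fin 4) → ZζEq (σ^ p γ (toℕ i) (W K p n s u))
                                    (σ^ p γ (toℕ j) (W K p n s u)) → i ≡ j))
proposition6p2 K p n s γ p-prime char-p order≡pⁿ 1≤s s-coprime γ-generator
               (w , _ , _ , w-cover) (u₀ , u₀≉0 , cycle) =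
  no-4-cycle-in-characteristic-5 K p n s γ p≡5 char-p γ-generator 2∤s u₀ cycle
  where
  open FourCycle K p n s γ p-prime char-p 1≤s s-coprime γ-generator w w-cover u₀ u₀≉0 cycle
    using (order≡5)
  p≡5 : p ≡ 5
  p≡5 = prime-power≡5⇒≡5 {n = n} p-prime (≡.trans (≡.sym order≡pⁿ) order≡5)
  2∤s : ¬ 2 ∣ s
  2∤s = coprime-4⇒¬2∣ (≡.subst (λ q → gcd s (q ∸ 1) ≡ 1) order≡5 s-coprime)
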